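{- Let $\mathbb S$ be the factorial association scheme with parameters $u_1,\dots,u_n$ and $\mathbb T$ its Terwilliger $\mathbb F$-algebra with respect to a point $\mathbf x$. Then $1/\dim_{\mathbb F}\mathrm Z(\mathbb T)$ equals the probability that a closed subset of $\mathbb S$ chosen uniformly at random is strongly normal, i.e. $\dfrac{1}{\dim_{\mathbb F}\mathrm Z(\mathbb T)}=\dfrac{\#\{\text{strongly normal closed subsets of }\mathbb S\}}{\#\{\text{closed subsets of }\mathbb S\}}$.
   Context: Let $n\ge1$ and let $\mathbb U_1,\dots,\mathbb U_n$ be finite sets with $|\mathbb U_a|=u_a\ge2$. Put $\mathbb X=\prod_a\mathbb U_a$, $d=2^n-1$. For $g\in[0,d]$ with binary expansion $g=\sum_{a=1}^n g_{(a)}2^{a-1}$ let $\mathbb P(g)=\{a:g_{(a)}=1\}$ and $R_g=\{(\mathbf u,\mathbf v)\in\mathbb X^2:\mathbf u_a\ne\mathbf v_a\iff a\in\mathbb P(g)\}$; $\mathbb S=\{R_0,\dots,R_d\}$. For $(\mathbf u,\mathbf v)\in R_i$, $p_{gh}^i=|\{\mathbf w:(\mathbf u,\mathbf w)\in R_g,(\mathbf w,\mathbf v)\in R_h\}|$. For nonempty $\mathbb A,\mathbb B\subseteq\mathbb S$, $\mathbb A\mathbb B=\{R_a:\exists R_b\in\mathbb A,R_c\in\mathbb B,\ p_{bc}^a>0\}$. A nonempty $\mathbb A\subseteq\mathbb S$ is closed if $\mathbb A\mathbb A\subseteq\mathbb A$; a closed $\mathbb A$ is strongly normal in $\mathbb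 S$ if $\{R_g\}\mathbb A\{R_g\}\subseteq\mathbb A$ for all $R_g\in\mathbb S$. For a field $\mathbb F$, $A_g$ is the $\{0,1\}$ adjacency matrix of $R_g$ in $M_{\mathbb X}(\mathbb F)$; fixing $\mathbf x$, $E_g^*$ is the diagonal $\{0,1\}$-matrix with $E_g^*(\mathbf u,\mathbf u)=1$ iff $(\mathbf x,\mathbf u)\in R_g$; $\mathbb T$ is the subalgebra generated by all $A_g,E_g^*$, and $\mathrm Z(\mathbb T)$ its center. -}

module Defs where

open import Level using (Level; _⊔_)
open import Data.Bool using (Bool; true; false; _∧_; not; if_then_else_; T)
open import Data.Nat using (ℕ; zero; suc; _^_; _≡ᵇ_; _<ᵇ_; _≤_)
open import Data.Nat.DivMod using (_/_; _%_)
open import Data.Fin using (Fin; toℕ; _≟_)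
import Data.Fin as Fin
import Data.Vec
open import Data.Fin.Subset using (Subset; Side; inside; outside; ⁅_⁆; _⊆_; Nonempty)
open import Data.Fin.Subset.Properties using (nonempty?; _⊆?_)
import Data.Fin.Properties as FinP
open import Data.List using (List; []; _∷_; [_]; map; concatMap; allFin; length; filter; filterᵇ; foldr)
open import Data.Vec using (tabulate)
open import Data.Bool.ListAction using (all; any)
open import Data.Product using (Σ; _×_; _,_; ∃)
open import Relation.Nullary using (Dec; does; ¬_)
open import Relation.Nullary.Decidable using (_×-dec_)
open import Relation.Binary.PropositionalEquality using (_≡_)
open import Algebra.Bundles using (CommutativeRing)

record Field (c ℓ : Level) : Set (Level.suc (c ⊔ ℓ)) where
  field
    commutativeRing : CommutativeRing c ℓ
  open CommutativeRing commutativeRing public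
  field
    0≉1     : ¬ (0# ≈ 1#)
    inverse : ∀ x → ¬ (x ≈ 0#) → Σ Carrier λ y → (x * y) ≈ 1#

-- The factorial scheme with parameters u : Fin n → ℕ.
-- Points of 𝕏 = ∏_a 𝕌_a, with 𝕌_a = Fin (u a).  Coordinates are indexed
-- 0 .. n-1 (paper: 1 .. n).

Pt : {n : ℕ} → (Fin n → ℕ) → Set
Pt {n} u = (a : Fin n) → Fin (u a)

private
  consPt : {n : ℕ} {u : Fin (suc n) → ℕ} → Fin (u Fin.zero) →
           ((a : Fin n) → Fin (u (Fin.suc a))) → Pt u
  consPt i f Fin.zero    = i
  consPt i f (Fin.suc a) = f a

allPts : {n : ℕ} (u : Fin n → ℕ) → List (Pt u)
allPts {zero}  u = [ (λ ()) ]
allPts {suc n} u =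
  concatMap (λ i → map (consPt i) (allPts (λ a → u (Fin.suc a)))) (allFin (u Fin.zero))

coordEq : {n : ℕ} {u : Fin n → ℕ} → Pt u → Pt u → Fin n → Bool
coordEq x y a = does (x a ≟ y a)

ptEq : {n : ℕ} {u : Fin n → ℕ} → Pt u → Pt u → Bool
ptEq {n} x y = all (coordEq x y) (allFin n)

boolEq : Bool → Bool → Bool
boolEq true  b = b
boolEq false b = not b

-- g_(a) : the a-th binary digit of g (a = 0 is the least significant)
-- binaryDigit k m : the k-th binary digit of m (k = 0 least significant)
binaryDigit : ℕ → ℕ → Bool
binaryDigit zero    m = (m % 2) ≡ᵇ 1
binaryDigit (suc k) m = binaryDigit k (m / 2)

bit : {n : ℕ} → Fin (2 ^ n) → Fin n → Bool
bit g a = binaryDigit (toℕ a) (toℕ g)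

-- (x , y) ∈ R_g  iff  for all a:  x_a ≠ y_a  ⇔  a ∈ ℙ(g)
inR : {n : ℕ} {u : Fin n → ℕ} → Fin (2 ^ n) → Pt u → Pt u → Bool
inR {n} g x y = all (λ a → boolEq (not (coordEq x y a)) (bit g a)) (allFin n)

-- |{ w : (x,w) ∈ R_g , (w,y) ∈ R_h }|   (= p_{gh}^i when (x,y) ∈ R_i)
pcount : {n : ℕ} (u : Fin n → ℕ) → Fin (2 ^ n) → Fin (2 ^ n) → Pt u → Pt u → ℕ
pcount u g h x y = length (filterᵇ (λ w → inR g x w ∧ inR h w y) (allPts u))

-- Subsets of 𝕊 = {R_0,…,R_d} are subsets of Fin (2 ^ n).

cprod : {n : ℕ} (u : Fin n → ℕ) → Subset (2 ^ n) → Subset (2 ^ n) → Subset (2 ^ n)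
cprod {n} u A B = tabulate λ a →
  any (λ b → any (λ c →
    Data.Vec.lookup A b ∧ Data.Vec.lookup B c ∧
    any (λ x → any (λ y → inR a x y ∧ (0 <ᵇ pcount u b c x y)) (allPts u)) (allPts u))
    (allFin (2 ^ n))) (allFin (2 ^ n))

Closed : {n : ℕ} (u : Fin n → ℕ) → Subset (2 ^ n) → Set
Closed u A = Nonempty A × (cprod u A A ⊆ A)

StronglyNormal : {n : ℕ} (u : Fin n → ℕ) → Subset (2 ^ n) → Set
StronglyNormal u A = Closed u A × (∀ g → cprod u (cprod u ⁅ g ⁆ A) ⁅ g ⁆ ⊆ A)

closed? : {n : ℕ} (u : Fin n → ℕ) → (A : Subset (2 ^ n)) → Dec (Closed u A)
closed? u A = nonempty? A ×-dec (cprod u A A ⊆? A)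

stronglyNormal? : {n : ℕ} (u : Fin n → ℕ) → (A : Subset (2 ^ n)) → Dec (StronglyNormal u A)
stronglyNormal? u A =
  closed? u A ×-dec FinP.all? (λ g → cprod u (cprod u ⁅ g ⁆ A) ⁅ g ⁆ ⊆? A)

allSubsets : (m : ℕ) → List (Subset m)
allSubsets zero    = [ Data.Vec.[] ]
allSubsets (suc m) = concatMap (λ s → (outside Data.Vec.∷ s) ∷ (inside Data.Vec.∷ s) ∷ []) (allSubsets m)

#closed : {n : ℕ} (u : Fin n → ℕ) → ℕ
#closed {n} u = length (filter (closed? u) (allSubsets (2 ^ n)))

#stronglyNormal : {n : ℕ} (u : Fin n → ℕ) → ℕ
#stronglyNormal {n} u = length (filter (stronglyNormal? u) (allSubsets (2 ^ n)))

module Terwilliger {c ℓ : Level} (F : Field c ℓ) {n : ℕ} (u : Fin n → ℕ) (base : Pt u) where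
  open Field F

  Mat : Set c
  Mat = Pt u → Pt u → Carrier

  _≈ₘ_ : Mat → Mat → Set ℓ
  M ≈ₘ N = ∀ x y → M x y ≈ N x y

  sumX : (Pt u → Carrier) → Carrier
  sumX f = foldr (λ w acc → f w + acc) 0# (allPts u)

  _*ₘ_ : Mat → Mat → Mat
  (M *ₘ N) x y = sumX (λ w → M x w * N w y)

  _+ₘ_ : Mat → Mat → Mat
  (M +ₘ N) x y = M x y + N x y

  _•ₘ_ : Carrier → Mat → Mat
  (k •ₘ M) x y = k * M x y

  0ₘ : Mat
  0ₘ x y = 0#

  1ₘ : Mat
  1ₘ x y = if ptEq x y then 1# else 0#

  Adj : Fin (2 ^ n) → Mat
  Adj g x y = if inR g x y then 1# else 0#

  Estar : Fin (2 ^ n) → Mat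
  Estar g x y = if ptEq x y ∧ inR g base x then 1# else 0#

  data Gen : Set where
    genA genE : Fin (2 ^ n) → Gen

  evalGen : Gen → Mat
  evalGen (genA g) = Adj g
  evalGen (genE g) = Estar g

  evalWord : List Gen → Mat
  evalWord []       = 1ₘ
  evalWord (s ∷ ws) = evalGen s *ₘ evalWord ws

  lincomb : List (Carrier × List Gen) → Mat
  lincomb []             = 0ₘ
  lincomb ((k , w) ∷ ts) = (k •ₘ evalWord w) +ₘ lincomb ts

  InT : Mat → Set (c ⊔ ℓ)
  InT M = Σ (List (Carrier × List Gen)) λ ts → M ≈ₘ lincomb ts

  InZ : Mat → Set (c ⊔ ℓ)
  InZ M = InT M × (∀ N → InT N → (M *ₘ N) ≈ₘ (N *ₘ M))

  combo : {m : ℕ} → (Fin m → Carrier) → (Fin m → Mat) → Mat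
  combo {zero}  k B = 0ₘ
  combo {suc m} k B = (k Fin.zero •ₘ B Fin.zero) +ₘ combo (λ i → k (Fin.suc i)) (λ i → B (Fin.suc i))

  IsBasisOfZ : {m : ℕ} → (Fin m → Mat) → Set (c ⊔ ℓ)
  IsBasisOfZ {m} B =
    (∀ i → InZ (B i)) ×
    (∀ (k : Fin m → Carrier) → combo k B ≈ₘ 0ₘ → ∀ i → k i ≈ 0#) ×
    (∀ M → InZ M → Σ (Fin m → Carrier) λ k → M ≈ₘ combo k B)

  DimZ≡ : ℕ → Set (c ⊔ ℓ)
  DimZ≡ m = Σ (Fin m → Mat) IsBasisOfZ

-- In one coordinate, three values x, w, y can realise every pattern of equalities allowed by transitivity,
-- except all three distinct when u_a = 2. So R_r ∈ {R_b}{R_c} is a coordinatewise condition (Triangle) in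
-- which the large coordinates, those with u_a ≥ 3, behave differently from the others.
--
-- A closed subset A is closed under symmetric difference of supports ℙ(g), and contains, with any g, every
-- relation whose support consists of large coordinates of g. Hence g ∈ A iff the small part of ℙ(g) is the
-- support of a member of A and the large coordinates of ℙ(g) lie in the set D of large coordinates used by A.
-- The strongly normal subsets are the closed ones using every large coordinate, and A ↦ (its saturation, D)
-- is a bijection from closed subsets onto pairs (strongly normal subset, set of large coordinates).
--
-- T is spanned by tensor products of coordinate matrices, and the E*_g A_h E*_k realise every function of
-- the relations of (base, x), (x, y) and (base, y). For every set Q of large coordinates the tensor Y_Q with
-- factor Z − I on Q and I elsewhere is central, since Z = E₁*JE₁* + (u_a − 1)E₀* commutes with J and the E*.
-- A central matrix vanishes unless x and y have the same base coordinates (it commutes with the E*_g), can be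
-- moved off the base coordinates (it commutes with E₁*JE₀* in one coordinate), and on points without base
-- coordinates it only depends on where they differ, a set of large coordinates (T is invariant under
-- coordinatewise permutations fixing the base point). So the Y_Q form a basis of Z(T), and dim Z(T) is the
-- number of sets of large coordinates, the factor by which closed subsets outnumber strongly normal ones.

module Submission where

open import Defs
open import Level using (Level; _⊔_)
open import Algebra.Bundles using (CommutativeSemiring; CommutativeRing)
open import Data.Bool using (Bool; true; false; _∧_; _∨_; not; _xor_; if_then_else_; T; T?)
import Data.Bool as Bool
open import Data.Bool.Properties using (T-∧; T-∨; T-≡; not-involutive; xor-identityʳ; ∧-identityʳ; ∧-zeroʳ; ∨-zeroʳ; ∨-identityʳ)
open import Data.Bool.ListAction using (all; and; any)
open import Data.Empty using (⊥; ⊥-elim)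
open import Data.Unit using (tt)
open import Data.Sum using ([_,_]′)
open import Data.Product using (Σ; ∃; _×_; _,_; proj₁; proj₂)
open import Data.Nat using (ℕ; zero; suc; _^_; _<_; _≤_; _≤?_; s≤s; z≤n; _≡ᵇ_; _<ᵇ_)
open import Data.Fin using (Fin; zero; suc; toℕ; fromℕ<; _≟_)
import Data.Fin.Properties as Fin
open import Data.Fin.Properties using (toℕ-fromℕ<; toℕ-injective; toℕ<n)
open import Data.Fin.Permutation using (Permutation′; _⟨$⟩ʳ_; _⟨$⟩ˡ_; _∘ₚ_; transpose; inverseˡ; inverseʳ)
open import Data.Fin.Subset using (Subset; inside; outside; _∈_; _⊆_)
open import Data.Fin.Subset.Properties using (_∈?_; _⊆?_; ⊆-antisym; x∈⁅x⁆; x∈⁅y⁆⇒x≡y)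
open import Data.Vec using (Vec; []; _∷_; tabulate; lookup)
import Data.Vec as Vec
open import Data.Vec.Properties using (lookup∘tabulate; tabulate∘lookup; tabulate-cong; ≡-dec; []=⇒lookup; lookup⇒[]=)
open import Data.List using (List; []; _∷_; foldr; map; concatMap; _++_; allFin; length; filter; filterᵇ)
import Data.List as List
open import Data.List.Properties using (map-tabulate; map-cong)
open import Data.List.Membership.Propositional using (lose) renaming (_∈_ to _∈ˡ_; _∉_ to _∉ˡ_)
open import Data.List.Membership.Propositional.Properties using (∈-map⁺; ∈-concatMap⁺; ∈-allFin; ∈-lookup; ∈-filter⁺; ∈-filter⁻)
open import Data.List.Relation.Unary.All using (All; []; _∷_)
import Data.List.Relation.Unary.All as All
import Data.List.Relation.Unary.All.Properties as All
open import Data.List.Relation.Unary.All.Properties using (all⁺; all⁻; tabulate⁺; tabulate⁻)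
open import Data.List.Relation.Unary.AllPairs as AllPairs using ([]; _∷_)
import Data.List.Relation.Unary.AllPairs.Properties as AllPairs
open import Data.List.Relation.Unary.Any using (Any; here; there; index)
import Data.List.Relation.Unary.Any as Any
open import Data.List.Relation.Unary.Any.Properties using (any⁺; any⁻; lookup-index)
open import Data.List.Relation.Unary.Unique.Propositional using (Unique)
open import Data.List.Relation.Unary.Unique.Propositional.Properties using (allFin⁺; concat⁺; filter⁺; Unique[x∷xs]⇒x∉xs)
open import Function using (_∘_; id; _⇔_; mk⇔; Equivalence)
open import Function.Construct.Composition using (_⇔-∘_)
open import Relation.Nullary using (Dec; does; yes; no; ¬_; contradiction)
open import Relation.Nullary.Decidable using (dec-true; dec-false; does-⇔; _×-dec_; _→-dec_)
open import Relation.Unary using (Decidable)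
open import Relation.Binary.Definitions using (DecidableEquality)
open import Relation.Binary.PropositionalEquality as ≡ using (_≡_; _≢_)

private variable
  a b : Level
  A : Set a
  B : Set b

all-allFin-suc : {m : ℕ} (p : Fin (suc m) → Bool) → all p (allFin (suc m)) ≡ (p zero ∧ all (p ∘ suc) (allFin m))
all-allFin-suc p = ≡.cong (p zero ∧_) (≡.cong and (≡.trans (map-tabulate suc p) (≡.sym (map-tabulate id (p ∘ suc)))))

all-cong : {p q : A → Bool} → (∀ x → p x ≡ q x) → (xs : List A) → all p xs ≡ all q xs
all-cong p≗q xs = ≡.cong and (map-cong p≗q xs)

boolEq-does : ∀ p q → boolEq p q ≡ does (p Bool.≟ q)
boolEq-does true  true  = ≡.refl
boolEq-does true  false = ≡.refl
boolEq-does false true  = ≡.refl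
boolEq-does false false = ≡.refl

T-boolEq : ∀ {p q} → T (boolEq p q) ⇔ p ≡ q
T-boolEq {true}  {true}  = mk⇔ (λ _ → ≡.refl) (λ _ → tt)
T-boolEq {true}  {false} = mk⇔ (λ ()) (λ ())
T-boolEq {false} {true}  = mk⇔ (λ ()) (λ ())
T-boolEq {false} {false} = mk⇔ (λ _ → ≡.refl) (λ _ → tt)

T-all-allFin : {m : ℕ} (p : Fin m → Bool) → T (all p (allFin m)) ⇔ (∀ a → T (p a))
T-all-allFin {m} p = mk⇔ (λ all-p → tabulate⁻ (all⁺ p (allFin m) all-p)) (λ ∀p → all⁻ p (tabulate⁺ ∀p))

boolEq-true : ∀ p → boolEq p true ≡ p
boolEq-true true  = ≡.refl
boolEq-true false = ≡.refl

boolEq-false : ∀ p → boolEq p false ≡ not p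
boolEq-false true  = ≡.refl
boolEq-false false = ≡.refl

T-does : (a? : Dec A) → T (does a?) ⇔ A
T-does (yes a) = mk⇔ (λ _ → a) (λ _ → tt)
T-does (no ¬a) = mk⇔ (λ ()) ¬a

-- Finite sums and products

module FiniteSums {c ℓ : Level} (S : CommutativeSemiring c ℓ) where
  open CommutativeSemiring S hiding (zero)
  open import Relation.Binary.Reasoning.Setoid setoid
  open import Algebra.Properties.CommutativeSemigroup +-commutativeSemigroup using () renaming (interchange to +-interchange)
  open import Algebra.Properties.CommutativeSemigroup *-commutativeSemigroup using (x∙yz≈y∙xz)
  open import Algebra.Properties.CommutativeMonoid.Sum *-commutativeMonoid public
    using () renaming (sum to ∏; sum-cong-≋ to ∏-cong; ∑-distrib-+ to ∏-distrib-*)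

  ∑ : List A → (A → Carrier) → Carrier
  ∑ xs f = foldr (λ x acc → f x + acc) 0# xs

  𝟙 : Bool → Carrier
  𝟙 b = if b then 1# else 0#

  ∑-cong : (xs : List A) {f g : A → Carrier} → (∀ x → f x ≈ g x) → ∑ xs f ≈ ∑ xs g
  ∑-cong []       f≈g = refl
  ∑-cong (x ∷ xs) f≈g = +-cong (f≈g x) (∑-cong xs f≈g)

  ∑-zero : (xs : List A) → ∑ xs (λ _ → 0#) ≈ 0#
  ∑-zero []       = refl
  ∑-zero (x ∷ xs) = trans (+-identityˡ _) (∑-zero xs)

  ∑-distrib-+ : (xs : List A) (f g : A → Carrier) → ∑ xs (λ x → f x + g x) ≈ ∑ xs f + ∑ xs g
  ∑-distrib-+ []       f g = sym (+-identityˡ 0#)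
  ∑-distrib-+ (x ∷ xs) f g = trans (+-congˡ (∑-distrib-+ xs f g)) (+-interchange _ _ _ _)

  *-distribˡ-∑ : (xs : List A) (k : Carrier) (f : A → Carrier) → k * ∑ xs f ≈ ∑ xs (λ x → k * f x)
  *-distribˡ-∑ []       k f = zeroʳ k
  *-distribˡ-∑ (x ∷ xs) k f = trans (distribˡ k _ _) (+-congˡ (*-distribˡ-∑ xs k f))

  *-distribʳ-∑ : (xs : List A) (k : Carrier) (f : A → Carrier) → ∑ xs f * k ≈ ∑ xs (λ x → f x * k)
  *-distribʳ-∑ []       k f = zeroˡ k
  *-distribʳ-∑ (x ∷ xs) k f = trans (distribʳ k _ _) (+-congˡ (*-distribʳ-∑ xs k f))

  ∑-++ : (xs ys : List A) (f : A → Carrier) → ∑ (xs ++ ys) f ≈ ∑ xs f + ∑ ys f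
  ∑-++ []       ys f = sym (+-identityˡ _)
  ∑-++ (x ∷ xs) ys f = trans (+-congˡ (∑-++ xs ys f)) (sym (+-assoc _ _ _))

  ∑-map : (h : B → A) (xs : List B) (f : A → Carrier) → ∑ (map h xs) f ≡ ∑ xs (f ∘ h)
  ∑-map h []       f = ≡.refl
  ∑-map h (x ∷ xs) f = ≡.cong (f (h x) +_) (∑-map h xs f)

  ∑-concatMap : (h : B → List A) (xs : List B) (f : A → Carrier) →
                ∑ (concatMap h xs) f ≈ ∑ xs (λ x → ∑ (h x) f)
  ∑-concatMap h []       f = refl
  ∑-concatMap h (x ∷ xs) f = trans (∑-++ (h x) (concatMap h xs) f) (+-congˡ (∑-concatMap h xs f))

  ∑-comm : (xs : List A) (ys : List B) (f : A → B → Carrier) →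
           ∑ xs (λ x → ∑ ys (f x)) ≈ ∑ ys (λ y → ∑ xs (λ x → f x y))
  ∑-comm []       ys f = sym (∑-zero ys)
  ∑-comm (x ∷ xs) ys f =
    trans (+-congˡ (∑-comm xs ys f)) (sym (∑-distrib-+ ys (f x) (λ y → ∑ xs (λ x′ → f x′ y))))

  ∑-tabulate : (m : ℕ) (g : Fin m → A) (f : A → Carrier) → ∑ (List.tabulate g) f ≡ ∑ (allFin m) (f ∘ g)
  ∑-tabulate zero    g f = ≡.refl
  ∑-tabulate (suc m) g f =
    ≡.cong (f (g zero) +_) (≡.trans (∑-tabulate m (g ∘ suc) f) (≡.sym (∑-tabulate m suc (f ∘ g))))

  ∑-allFin-suc : (m : ℕ) (f : Fin (suc m) → Carrier) → ∑ (allFin (suc m)) f ≡ f zero + ∑ (allFin m) (f ∘ suc)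
  ∑-allFin-suc m f = ≡.cong (f zero +_) (∑-tabulate m suc f)

  𝟙-∧ : ∀ p q → 𝟙 (p ∧ q) ≈ 𝟙 p * 𝟙 q
  𝟙-∧ true  q = sym (*-identityˡ _)
  𝟙-∧ false q = sym (zeroˡ _)

  𝟙-not : ∀ p → 𝟙 (not p) + 𝟙 p ≈ 1#
  𝟙-not true  = +-identityˡ _
  𝟙-not false = +-identityʳ _

  𝟙-all : {m : ℕ} (p : Fin m → Bool) → 𝟙 (all p (allFin m)) ≈ ∏ (𝟙 ∘ p)
  𝟙-all {zero}  p = refl
  𝟙-all {suc m} p = trans (reflexive (≡.cong 𝟙 (all-allFin-suc p))) (trans (𝟙-∧ _ _) (*-congˡ (𝟙-all (p ∘ suc))))

  ∏-pull : {m : ℕ} (f : Fin m → Carrier) (a₀ : Fin m) → ∏ f ≈ f a₀ * ∏ (λ a → if does (a Fin.≟ a₀) then 1# else f a)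
  ∏-pull f zero     = *-congˡ (sym (*-identityˡ _))
  ∏-pull f (suc a₀) = begin
    f zero * ∏ (f ∘ suc)              ≈⟨ *-congˡ (∏-pull (f ∘ suc) a₀) ⟩
    f zero * (f (suc a₀) * rest)      ≈⟨ x∙yz≈y∙xz _ _ _ ⟩
    f (suc a₀) * (f zero * rest)      ∎
    where
    rest = ∏ (λ a → if does (a Fin.≟ a₀) then 1# else f (suc a))

  ∏-boolEq : {m : ℕ} (p q : Vec Bool m) → ∏ (λ a → 𝟙 (boolEq (Vec.lookup p a) (Vec.lookup q a))) ≈ 𝟙 (does (≡-dec Bool._≟_ p q))
  ∏-boolEq Vec.[]       Vec.[]       = refl
  ∏-boolEq (p Vec.∷ ps) (q Vec.∷ qs) = trans (*-cong (reflexive (≡.cong 𝟙 (boolEq-does p q))) (∏-boolEq ps qs)) (sym (𝟙-∧ _ _))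

  module _ (_≟_ : DecidableEquality A) where

    ∑-δ-∉ : ∀ {x xs} (f : A → Carrier) → x ∉ˡ xs → ∑ xs (λ y → 𝟙 (does (y ≟ x)) * f y) ≈ 0#
    ∑-δ-∉ {x} {[]}     f x∉ = refl
    ∑-δ-∉ {x} {y ∷ xs} f x∉ with y ≟ x
    ... | yes ≡.refl = contradiction (here ≡.refl) x∉
    ... | no  _      = trans (+-cong (zeroˡ _) (∑-δ-∉ f (x∉ ∘ there))) (+-identityˡ 0#)

    ∑-δʳ : ∀ {x xs} (f : A → Carrier) → Unique xs → x ∈ˡ xs → ∑ xs (λ y → 𝟙 (does (y ≟ x)) * f y) ≈ f x
    ∑-δʳ {x} {y ∷ xs} f uniq@(_ ∷ uniq′) x∈ with y ≟ x | x∈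
    ... | yes ≡.refl | _ = trans (+-cong (*-identityˡ _) (∑-δ-∉ f (Unique[x∷xs]⇒x∉xs uniq))) (+-identityʳ _)
    ... | no y≢x | here x≡y = contradiction (≡.sym x≡y) y≢x
    ... | no _   | there x∈xs = trans (+-cong (zeroˡ _) (∑-δʳ f uniq′ x∈xs)) (+-identityˡ _)

    ∑-δˡ : ∀ {x xs} (f : A → Carrier) → Unique xs → x ∈ˡ xs → ∑ xs (λ y → 𝟙 (does (x ≟ y)) * f y) ≈ f x
    ∑-δˡ {x} {xs} f uniq x∈ =
      trans (∑-cong xs (λ y → *-congʳ (reflexive (≡.cong 𝟙 (does-⇔ (mk⇔ ≡.sym ≡.sym) (x ≟ y) (y ≟ x))))))
            (∑-δʳ f uniq x∈)

  ∑-permute : {m : ℕ} (π : Permutation′ m) (f : Fin m → Carrier) → ∑ (allFin m) (f ∘ (π ⟨$⟩ʳ_)) ≈ ∑ (allFin m) f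
  ∑-permute {m} π f = begin
    ∑ (allFin m) (λ k → f (π ⟨$⟩ʳ k))
      ≈⟨ ∑-cong (allFin m) (λ k → ∑-δˡ Fin._≟_ f (allFin⁺ m) (∈-allFin (π ⟨$⟩ʳ k))) ⟨
    ∑ (allFin m) (λ k → ∑ (allFin m) (λ l → 𝟙 (does (π ⟨$⟩ʳ k Fin.≟ l)) * f l))
      ≈⟨ ∑-comm (allFin m) (allFin m) _ ⟩
    ∑ (allFin m) (λ l → ∑ (allFin m) (λ k → 𝟙 (does (π ⟨$⟩ʳ k Fin.≟ l)) * f l))
      ≈⟨ ∑-cong (allFin m) (λ l → ∑-cong (allFin m) (λ k → *-congʳ (reflexive (≡.cong 𝟙 (moved k l))))) ⟩
    ∑ (allFin m) (λ l → ∑ (allFin m) (λ k → 𝟙 (does (k Fin.≟ π ⟨$⟩ˡ l)) * f l))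
      ≈⟨ ∑-cong (allFin m) (λ l → ∑-δʳ Fin._≟_ (λ _ → f l) (allFin⁺ m) (∈-allFin (π ⟨$⟩ˡ l))) ⟩
    ∑ (allFin m) f ∎
    where
    moved : ∀ k l → does (π ⟨$⟩ʳ k Fin.≟ l) ≡ does (k Fin.≟ π ⟨$⟩ˡ l)
    moved k l = does-⇔ (mk⇔ (λ { ≡.refl → ≡.sym (inverseˡ π) }) (λ { ≡.refl → inverseʳ π }))
                       (π ⟨$⟩ʳ k Fin.≟ l) (k Fin.≟ π ⟨$⟩ˡ l)

-- Binary digits of relation indices

module _ where
  open import Data.Nat using (_+_; _*_)
  open import Data.Nat.Properties using (*-comm; ≤-refl; *-monoˡ-≤; ≤-trans; n≤1+n)
  open import Data.Nat.DivMod using (_/_; _%_; [m+kn]%n≡m%n; m*n/n≡m; +-distrib-/; m≡m%n+[m/n]*n; m%n<n; m<n*o⇒m/o<n; m*n%n≡0)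

  private
    bitValue : Bool → ℕ
    bitValue b = if b then 1 else 0

    fromDigits : {n : ℕ} → (Fin n → Bool) → ℕ
    fromDigits {zero}  f = 0
    fromDigits {suc n} f = bitValue (f zero) + fromDigits (f ∘ suc) * 2

    fromDigits< : {n : ℕ} (f : Fin n → Bool) → fromDigits f < 2 ^ n
    fromDigits< {zero}  f = s≤s z≤n
    fromDigits< {suc n} f =
      ≤-trans (step (f zero) e) (≡.subst (suc e * 2 ≤_) (*-comm (2 ^ n) 2) (*-monoˡ-≤ 2 (fromDigits< (f ∘ suc))))
      where
      e = fromDigits (f ∘ suc)
      step : ∀ b e → suc (bitValue b + e * 2) ≤ suc e * 2
      step false e = s≤s (n≤1+n (e * 2))
      step true  e = ≤-refl

  encode : {n : ℕ} → (Fin n → Bool) → Fin (2 ^ n)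
  encode f = fromℕ< (fromDigits< f)

  private
    lowestDigit : ∀ b e → binaryDigit 0 (bitValue b + e * 2) ≡ b
    lowestDigit false e = ≡.cong (_≡ᵇ 1) ([m+kn]%n≡m%n 0 e 2)
    lowestDigit true  e = ≡.cong (_≡ᵇ 1) ([m+kn]%n≡m%n 1 e 2)

    shiftDigits : ∀ b e → (bitValue b + e * 2) / 2 ≡ e
    shiftDigits false e = m*n/n≡m e 2
    shiftDigits true  e = ≡.trans (+-distrib-/ 1 (e * 2) (≡.subst (λ k → 1 + k < 2) (≡.sym (m*n%n≡0 e 2)) ≤-refl)) (m*n/n≡m e 2)

    binaryDigit-fromDigits : {n : ℕ} (f : Fin n → Bool) (a : Fin n) → binaryDigit (toℕ a) (fromDigits f) ≡ f a
    binaryDigit-fromDigits {suc n} f zero    = lowestDigit (f zero) (fromDigits (f ∘ suc))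
    binaryDigit-fromDigits {suc n} f (suc a) =
      ≡.trans (≡.cong (binaryDigit (toℕ a)) (shiftDigits (f zero) _)) (binaryDigit-fromDigits (f ∘ suc) a)

    fromDigits-cong : {n : ℕ} {f g : Fin n → Bool} → (∀ a → f a ≡ g a) → fromDigits f ≡ fromDigits g
    fromDigits-cong {zero}  f≗g = ≡.refl
    fromDigits-cong {suc n} f≗g = ≡.cong₂ (λ b e → bitValue b + e * 2) (f≗g zero) (fromDigits-cong (f≗g ∘ suc))

    fromDigits-binaryDigit : (n m : ℕ) → m < 2 ^ n → fromDigits {n} (λ a → binaryDigit (toℕ a) m) ≡ m
    fromDigits-binaryDigit zero    zero    _ = ≡.refl
    fromDigits-binaryDigit zero    (suc m) (s≤s ())
    fromDigits-binaryDigit (suc n) m m<2^1+n = begin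
      bitValue ((m % 2) ≡ᵇ 1) + fromDigits {n} (λ a → binaryDigit (toℕ a) (m / 2)) * 2
        ≡⟨ ≡.cong₂ (λ b e → b + e * 2) (bitValue-digit (m % 2) (m%n<n m 2))
                 (fromDigits-binaryDigit n (m / 2) (m<n*o⇒m/o<n (≡.subst (m <_) (*-comm 2 (2 ^ n)) m<2^1+n))) ⟩
      m % 2 + (m / 2) * 2 ≡⟨ m≡m%n+[m/n]*n m 2 ⟨
      m                   ∎
      where
      open ≡.≡-Reasoning
      bitValue-digit : ∀ r → r < 2 → bitValue (r ≡ᵇ 1) ≡ r
      bitValue-digit zero          _ = ≡.refl
      bitValue-digit (suc zero)    _ = ≡.refl
      bitValue-digit (suc (suc r)) (s≤s (s≤s ()))

  bit-encode : {n : ℕ} (f : Fin n → Bool) (a : Fin n) → bit (encode f) a ≡ f a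
  bit-encode f a = ≡.trans (≡.cong (binaryDigit (toℕ a)) (toℕ-fromℕ< (fromDigits< f))) (binaryDigit-fromDigits f a)

  bit-injective : {n : ℕ} {g h : Fin (2 ^ n)} → (∀ a → bit {n} g a ≡ bit h a) → g ≡ h
  bit-injective {n} {g} {h} bits≡ = toℕ-injective (begin
    toℕ g                 ≡⟨ fromDigits-binaryDigit n (toℕ g) (toℕ<n g) ⟨
    fromDigits (bit {n} g) ≡⟨ fromDigits-cong {n} bits≡ ⟩
    fromDigits (bit {n} h) ≡⟨ fromDigits-binaryDigit n (toℕ h) (toℕ<n h) ⟩
    toℕ h                 ∎)
    where open ≡.≡-Reasoning

  encode-bit : {n : ℕ} (g : Fin (2 ^ n)) → encode (bit {n} g) ≡ g
  encode-bit {n} g = bit-injective {n} (bit-encode (bit {n} g))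

  encode-cong : {n : ℕ} {f g : Fin n → Bool} → (∀ a → f a ≡ g a) → encode f ≡ encode g
  encode-cong {n} {f} {g} f≗g = bit-injective {n} (λ a → ≡.trans (bit-encode f a) (≡.trans (f≗g a) (≡.sym (bit-encode g a))))

bits-encode : {n : ℕ} (f : Fin n → Bool) (g : Fin (2 ^ n)) → (∀ a → f a ≡ bit g a) ⇔ g ≡ encode f
bits-encode {n} f g = mk⇔ (λ f≗g → bit-injective {n} (λ a → ≡.trans (≡.sym (f≗g a)) (≡.sym (bit-encode f a))))
                          (λ { ≡.refl a → ≡.sym (bit-encode f a) })

relation : {n : ℕ} {u : Fin n → ℕ} → Pt u → Pt u → Fin (2 ^ n)
relation x y = encode (λ a → not (coordEq x y a))

inR-relation : {n : ℕ} {u : Fin n → ℕ} (g : Fin (2 ^ n)) (x y : Pt u) → inR g x y ≡ does (g ≟ relation x y)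
inR-relation {n} g x y = does-⇔ (mk⇔ to from) (T? (inR g x y)) (g ≟ relation x y)
  where
  f : Fin n → Bool
  f a = not (coordEq x y a)
  to : T (inR g x y) → g ≡ relation x y
  to inR-g = Equivalence.to (bits-encode f g) (λ a → Equivalence.to T-boolEq (Equivalence.to (T-all-allFin _) inR-g a))
  from : g ≡ relation x y → T (inR g x y)
  from ≡.refl = Equivalence.from (T-all-allFin _) (λ a → Equivalence.from T-boolEq (≡.sym (bit-encode f a)))

-- Finite sets and their permutations

three-distinct : {m : ℕ} {i j k : Fin m} → i ≢ j → j ≢ k → i ≢ k → 3 ≤ m
three-distinct {suc (suc (suc _))} _ _ _ = s≤s (s≤s (s≤s z≤n))
three-distinct {1} {zero} {zero} i≢j _ _ = contradiction ≡.refl i≢j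
three-distinct {2} {zero} {zero} i≢j _ _ = contradiction ≡.refl i≢j
three-distinct {2} {suc zero} {suc zero} i≢j _ _ = contradiction ≡.refl i≢j
three-distinct {2} {zero} {suc zero} {zero} _ _ i≢k = contradiction ≡.refl i≢k
three-distinct {2} {suc zero} {zero} {suc zero} _ _ i≢k = contradiction ≡.refl i≢k
three-distinct {2} {zero} {suc zero} {suc zero} _ j≢k _ = contradiction ≡.refl j≢k
three-distinct {2} {suc zero} {zero} {zero} _ j≢k _ = contradiction ≡.refl j≢k

other₁ : {m : ℕ} → 2 ≤ m → Fin m → Fin m
other₁ (s≤s (s≤s _)) zero    = suc zero
other₁ (s≤s (s≤s _)) (suc _) = zero

other₂ : {m : ℕ} → 2 ≤ m → Fin m → Fin m
other₂ {suc zero} (s≤s ()) b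
other₂ {suc (suc zero)}    2≤m b            = other₁ 2≤m b
other₂ {suc (suc (suc _))} _   zero         = suc (suc zero)
other₂ {suc (suc (suc _))} _   (suc zero)   = suc (suc zero)
other₂ {suc (suc (suc _))} _   (suc (suc _)) = suc zero

other₁-≢ : {m : ℕ} (2≤m : 2 ≤ m) (b : Fin m) → b ≢ other₁ 2≤m b
other₁-≢ (s≤s (s≤s _)) zero    ()
other₁-≢ (s≤s (s≤s _)) (suc _) ()

other₂-≢ : {m : ℕ} (2≤m : 2 ≤ m) (b : Fin m) → b ≢ other₂ 2≤m b
other₂-≢ {suc zero} (s≤s ()) b
other₂-≢ {suc (suc zero)}    2≤m b = other₁-≢ 2≤m b
other₂-≢ {suc (suc (suc _))} _ zero          ()
other₂-≢ {suc (suc (suc _))} _ (suc zero)    ()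
other₂-≢ {suc (suc (suc _))} _ (suc (suc _)) ()

other₁-≢-other₂ : {m : ℕ} (2≤m : 2 ≤ m) (b : Fin m) → 3 ≤ m → other₁ 2≤m b ≢ other₂ 2≤m b
other₁-≢-other₂ {suc (suc zero)} _ _ (s≤s (s≤s ()))
other₁-≢-other₂ {suc (suc (suc _))} (s≤s (s≤s _)) zero          _ ()
other₁-≢-other₂ {suc (suc (suc _))} (s≤s (s≤s _)) (suc zero)    _ ()
other₁-≢-other₂ {suc (suc (suc _))} (s≤s (s≤s _)) (suc (suc _)) _ ()

module _ {n : ℕ} {u : Fin n → ℕ} where

  _[_≔_] : (x : Pt u) (a : Fin n) → Fin (u a) → Pt u
  (x [ a ≔ i ]) a′ with a ≟ a′
  ... | yes ≡.refl = i
  ... | no  _      = x a′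

  update-same : (x : Pt u) (a : Fin n) (i : Fin (u a)) → (x [ a ≔ i ]) a ≡ i
  update-same x a i with a ≟ a
  ... | yes ≡.refl = ≡.refl
  ... | no  a≢a    = contradiction ≡.refl a≢a

  update-other : (x : Pt u) (a : Fin n) (i : Fin (u a)) {a′ : Fin n} → a′ ≢ a → (x [ a ≔ i ]) a′ ≡ x a′
  update-other x a i {a′} a′≢a with a ≟ a′
  ... | yes ≡.refl = contradiction ≡.refl a′≢a
  ... | no  _      = ≡.refl

module _ {m : ℕ} where

  transpose-left : (i j : Fin m) → transpose i j ⟨$⟩ʳ i ≡ j
  transpose-left i j rewrite dec-true (i ≟ i) ≡.refl = ≡.refl

  transpose-fixed : {i j k : Fin m} → k ≢ i → k ≢ j → transpose i j ⟨$⟩ʳ k ≡ k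
  transpose-fixed {i} {j} {k} k≢i k≢j rewrite dec-false (k ≟ i) k≢i | dec-false (k ≟ j) k≢j = ≡.refl

  permutation-injective : (σ : Permutation′ m) {i j : Fin m} → σ ⟨$⟩ʳ i ≡ σ ⟨$⟩ʳ j → i ≡ j
  permutation-injective σ σi≡σj = ≡.trans (≡.sym (inverseˡ σ)) (≡.trans (≡.cong (σ ⟨$⟩ˡ_) σi≡σj) (inverseˡ σ))

normalising-permutation : {m : ℕ} (2≤m : 2 ≤ m) {b x y : Fin m} → b ≢ x → b ≢ y →
  Σ (Permutation′ m) λ σ → σ ⟨$⟩ʳ b ≡ b × σ ⟨$⟩ʳ x ≡ other₁ 2≤m b ×
                           σ ⟨$⟩ʳ y ≡ (if does (x ≟ y) then other₁ 2≤m b else other₂ 2≤m b)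
normalising-permutation 2≤m {b} {x} {y} b≢x b≢y = τ₁ ∘ₚ τ₂ , fixes-b , moves-x , moves-y
  where
  o₁ = other₁ 2≤m b
  o₂ = other₂ 2≤m b
  t = if does (x ≟ y) then o₁ else o₂
  τ₁ = transpose x o₁
  y′ = τ₁ ⟨$⟩ʳ y
  τ₂ = transpose y′ t
  τ₁-b : τ₁ ⟨$⟩ʳ b ≡ b
  τ₁-b = transpose-fixed b≢x (other₁-≢ 2≤m b)
  b≢y′ : b ≢ y′
  b≢y′ b≡y′ = b≢y (permutation-injective τ₁ (≡.trans τ₁-b b≡y′))
  b≢t : b ≢ t
  b≢t with does (x ≟ y)
  ... | true  = other₁-≢ 2≤m b
  ... | false = other₂-≢ 2≤m b
  fixes-b : τ₂ ⟨$⟩ʳ (τ₁ ⟨$⟩ʳ b) ≡ b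
  fixes-b = ≡.trans (≡.cong (τ₂ ⟨$⟩ʳ_) τ₁-b) (transpose-fixed b≢y′ b≢t)
  moves-y : τ₂ ⟨$⟩ʳ y′ ≡ t
  moves-y = transpose-left y′ t
  moves-x : τ₂ ⟨$⟩ʳ (τ₁ ⟨$⟩ʳ x) ≡ o₁
  moves-x = by-cases (x ≟ y)
    where
    by-cases : Dec (x ≡ y) → τ₂ ⟨$⟩ʳ (τ₁ ⟨$⟩ʳ x) ≡ o₁
    by-cases (yes x≡y) = ≡.trans (≡.cong (λ z → τ₂ ⟨$⟩ʳ (τ₁ ⟨$⟩ʳ z)) x≡y)
                                 (≡.trans moves-y (≡.cong (if_then o₁ else o₂) (dec-true (x ≟ y) x≡y)))
    by-cases (no  x≢y) = ≡.trans (≡.cong (τ₂ ⟨$⟩ʳ_) (transpose-left x o₁)) (transpose-fixed o₁≢y′ o₁≢t)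
      where
      o₁≢y′ : o₁ ≢ y′
      o₁≢y′ o₁≡y′ = x≢y (permutation-injective τ₁ (≡.trans (transpose-left x o₁) o₁≡y′))
      o₁≢t : o₁ ≢ t
      o₁≢t rewrite dec-false (x ≟ y) x≢y = other₁-≢-other₂ 2≤m b (three-distinct b≢x x≢y b≢y)

-- Subsets and enumerations

allSubsets-complete : {m : ℕ} (s : Subset m) → s ∈ˡ allSubsets m
allSubsets-complete []               = here ≡.refl
allSubsets-complete (outside ∷ s) = ∈-concatMap⁺ _ (Any.map (λ { ≡.refl → here ≡.refl }) (allSubsets-complete s))
allSubsets-complete (inside ∷ s)  = ∈-concatMap⁺ _ (Any.map (λ { ≡.refl → there (here ≡.refl) }) (allSubsets-complete s))

allSubsets-unique : (m : ℕ) → Unique (allSubsets m)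
allSubsets-unique zero    = [] ∷ []
allSubsets-unique (suc m) = concat⁺ (All.map⁺ (All.universal (λ _ → ((λ ()) ∷ []) ∷ [] ∷ []) _))
                                    (AllPairs.map⁺ (AllPairs.map disjoint (allSubsets-unique m)))
  where
  disjoint : ∀ {s t : Subset m} → s ≢ t → _
  disjoint s≢t (here ≡.refl         , here ≡.refl)         = s≢t ≡.refl
  disjoint s≢t (here ≡.refl         , there (here ()))
  disjoint s≢t (there (here ≡.refl) , here ())
  disjoint s≢t (there (here ≡.refl) , there (here ≡.refl)) = s≢t ≡.refl

lookup-injective : {A : Set} {xs : List A} → Unique xs → {i j : Fin (length xs)} → List.lookup xs i ≡ List.lookup xs j → i ≡ j
lookup-injective {xs = x ∷ xs} (x∉ ∷ uniq) {zero}  {zero}  _   = ≡.refl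
lookup-injective {xs = x ∷ xs} (x∉ ∷ uniq) {zero}  {suc j} x≡  = contradiction x≡ (All.lookup x∉ (∈-lookup _))
lookup-injective {xs = x ∷ xs} (x∉ ∷ uniq) {suc i} {zero}  ≡x  = contradiction (≡.sym ≡x) (All.lookup x∉ (∈-lookup _))
lookup-injective {xs = x ∷ xs} (x∉ ∷ uniq) {suc i} {suc j} eq  = ≡.cong suc (lookup-injective uniq eq)

∈⇔T-lookup : {m : ℕ} {p : Subset m} {a : Fin m} → a ∈ p ⇔ T (lookup p a)
∈⇔T-lookup {p = p} {a} = mk⇔ (λ a∈ → Equivalence.from T-≡ ([]=⇒lookup a∈)) (λ t → lookup⇒[]= a p (Equivalence.to T-≡ t))

∈-tabulate : {m : ℕ} {f : Fin m → Bool} {a : Fin m} → a ∈ tabulate f ⇔ T (f a)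
∈-tabulate {f = f} {a} = mk⇔ (λ a∈ → ≡.subst T (lookup∘tabulate f a) (Equivalence.to ∈⇔T-lookup a∈))
                             (λ t → Equivalence.from ∈⇔T-lookup (≡.subst T (≡.sym (lookup∘tabulate f a)) t))

lookup-extensionality : {m : ℕ} {p q : Subset m} → (∀ a → lookup p a ≡ lookup q a) → p ≡ q
lookup-extensionality {p = p} {q} p≗q = ≡.trans (≡.sym (tabulate∘lookup p)) (≡.trans (tabulate-cong p≗q) (tabulate∘lookup q))

⟦_⟧ : {m : ℕ} {P : Fin m → Set} → Decidable P → Subset m
⟦ P? ⟧ = tabulate (does ∘ P?)

∈⟦⟧ : {m : ℕ} {P : Fin m → Set} (P? : Decidable P) {a : Fin m} → a ∈ ⟦ P? ⟧ ⇔ P a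
∈⟦⟧ P? {a} = T-does (P? a) ⇔-∘ ∈-tabulate

Large : {n : ℕ} → (Fin n → ℕ) → Subset n
Large u = ⟦ (λ a → 3 ≤? u a) ⟧

∈-Large : {n : ℕ} {u : Fin n → ℕ} {a : Fin n} → a ∈ Large u ⇔ 3 ≤ u a
∈-Large {u = u} = ∈⟦⟧ (λ a → 3 ≤? u a)

subsetsOf : {n : ℕ} → Subset n → List (Subset n)
subsetsOf {n} s = filter (_⊆? s) (allSubsets n)

module _ {c ℓ : Level} (S : CommutativeSemiring c ℓ) where
  open CommutativeSemiring S hiding (zero)
  open FiniteSums S

  ∑-lookup-δ : {A : Set} (_≟_ : DecidableEquality A) {xs : List A} → Unique xs → (k : Fin (length xs) → Carrier) (i : Fin (length xs)) →
               ∑ (allFin (length xs)) (λ j → k j * 𝟙 (does (List.lookup xs j ≟ List.lookup xs i))) ≈ k i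
  ∑-lookup-δ _≟_ {xs} uniq k i = trans
    (∑-cong (allFin (length xs)) (λ j → trans (*-comm _ _) (*-congʳ (reflexive (≡.cong 𝟙
      (does-⇔ (mk⇔ (lookup-injective uniq) (≡.cong (List.lookup xs))) (List.lookup xs j ≟ List.lookup xs i) (j Fin.≟ i)))))))
    (∑-δʳ Fin._≟_ k (allFin⁺ (length xs)) (∈-allFin i))

-- Counting along a bijection

module Counting where
  open import Data.Nat using (_*_)
  open import Data.Nat.Properties using (+-*-commutativeSemiring; *-comm)

  open FiniteSums +-*-commutativeSemiring

  length-filter : {A : Set} {P : A → Set} (P? : Decidable P) (xs : List A) → length (filter P? xs) ≡ ∑ xs (𝟙 ∘ does ∘ P?)
  length-filter P? []       = ≡.refl
  length-filter P? (x ∷ xs) with does (P? x)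
  ... | true  = ≡.cong suc (length-filter P? xs)
  ... | false = length-filter P? xs

  record Enumeration (A : Set) : Set where
    field
      _≟ₑ_     : DecidableEquality A
      elements : List A
      unique   : Unique elements
      complete : ∀ x → x ∈ˡ elements

  module _ {X Y Z : Set} (EX : Enumeration X) (EY : Enumeration Y) (EZ : Enumeration Z)
           {P : X → Set} (P? : Decidable P) {Q : Y → Set} (Q? : Decidable Q) {R : Z → Set} (R? : Decidable R)
           (φ : Y → Z → X) (ψ₁ : X → Y) (ψ₂ : X → Z)
           (φ-preserves : ∀ {y z} → Q y → R z → P (φ y z))
           (ψ-preserves : ∀ {x} → P x → Q (ψ₁ x) × R (ψ₂ x))
           (φ∘ψ : ∀ {x} → P x → φ (ψ₁ x) (ψ₂ x) ≡ x)
           (ψ∘φ : ∀ {y z} → Q y → R z → ψ₁ (φ y z) ≡ y × ψ₂ (φ y z) ≡ z) where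

    open Enumeration EX renaming (_≟ₑ_ to _≟X_; elements to xs; unique to xs-unique; complete to xs-complete)
    open Enumeration EY renaming (_≟ₑ_ to _≟Y_; elements to ys; unique to ys-unique; complete to ys-complete)
    open Enumeration EZ renaming (_≟ₑ_ to _≟Z_; elements to zs; unique to zs-unique; complete to zs-complete)

    private
      [_] : {A : Set} → Dec A → ℕ
      [ a? ] = 𝟙 (does a?)

      fibre : ∀ x y z → [ (R? z ×-dec Q? y) ×-dec (x ≟X φ y z) ] ≡ [ z ≟Z ψ₂ x ×-dec (y ≟Y ψ₁ x ×-dec P? x) ]
      fibre x y z = ≡.cong 𝟙 (does-⇔ (mk⇔ to from) ((R? z ×-dec Q? y) ×-dec (x ≟X φ y z)) (z ≟Z ψ₂ x ×-dec (y ≟Y ψ₁ x ×-dec P? x)))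
        where
        to : (R z × Q y) × x ≡ φ y z → z ≡ ψ₂ x × (y ≡ ψ₁ x × P x)
        to ((Rz , Qy) , ≡.refl) = ≡.sym (proj₂ (ψ∘φ Qy Rz)) , ≡.sym (proj₁ (ψ∘φ Qy Rz)) , φ-preserves Qy Rz
        from : z ≡ ψ₂ x × (y ≡ ψ₁ x × P x) → (R z × Q y) × x ≡ φ y z
        from (≡.refl , ≡.refl , Px) = (proj₂ (ψ-preserves Px) , proj₁ (ψ-preserves Px)) , ≡.sym (φ∘ψ Px)

      fibres : ∀ x → ∑ zs (λ z → ∑ ys (λ y → [ (R? z ×-dec Q? y) ×-dec (x ≟X φ y z) ])) ≡ [ P? x ]
      fibres x = begin
        ∑ zs (λ z → ∑ ys (λ y → [ (R? z ×-dec Q? y) ×-dec (x ≟X φ y z) ]))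
          ≡⟨ ∑-cong zs (λ z → ∑-cong ys (λ y → ≡.trans (fibre x y z)
               (≡.trans (𝟙-∧ (does (z ≟Z ψ₂ x)) _) (≡.cong ([ z ≟Z ψ₂ x ] *_) (𝟙-∧ (does (y ≟Y ψ₁ x)) (does (P? x))))))) ⟩
        ∑ zs (λ z → ∑ ys (λ y → [ z ≟Z ψ₂ x ] * ([ y ≟Y ψ₁ x ] * [ P? x ])))
          ≡⟨ ∑-cong zs (λ z → *-distribˡ-∑ ys [ z ≟Z ψ₂ x ] (λ y → [ y ≟Y ψ₁ x ] * [ P? x ])) ⟨
        ∑ zs (λ z → [ z ≟Z ψ₂ x ] * ∑ ys (λ y → [ y ≟Y ψ₁ x ] * [ P? x ]))
          ≡⟨ ∑-cong zs (λ z → ≡.cong ([ z ≟Z ψ₂ x ] *_) (∑-δʳ _≟Y_ (λ _ → [ P? x ]) ys-unique (ys-complete (ψ₁ x)))) ⟩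
        ∑ zs (λ z → [ z ≟Z ψ₂ x ] * [ P? x ])
          ≡⟨ ∑-δʳ _≟Z_ (λ _ → [ P? x ]) zs-unique (zs-complete (ψ₂ x)) ⟩
        [ P? x ] ∎
        where open ≡.≡-Reasoning

      fibre-size : ∀ y z → ∑ xs (λ x → [ (R? z ×-dec Q? y) ×-dec (x ≟X φ y z) ]) ≡ [ R? z ] * [ Q? y ]
      fibre-size y z = begin
        ∑ xs (λ x → [ (R? z ×-dec Q? y) ×-dec (x ≟X φ y z) ])
          ≡⟨ ∑-cong xs (λ x → ≡.trans (𝟙-∧ (does (R? z ×-dec Q? y)) _)
               (≡.trans (*-comm [ R? z ×-dec Q? y ] _) (≡.cong ([ x ≟X φ y z ] *_) (𝟙-∧ (does (R? z)) (does (Q? y)))))) ⟩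
        ∑ xs (λ x → [ x ≟X φ y z ] * ([ R? z ] * [ Q? y ]))
          ≡⟨ ∑-δʳ _≟X_ (λ _ → [ R? z ] * [ Q? y ]) xs-unique (xs-complete (φ y z)) ⟩
        [ R? z ] * [ Q? y ] ∎
        where open ≡.≡-Reasoning

    count-by-bijection : length (filter P? xs) ≡ length (filter R? zs) * length (filter Q? ys)
    count-by-bijection = begin
      length (filter P? xs)
        ≡⟨ length-filter P? xs ⟩
      ∑ xs (λ x → [ P? x ])
        ≡⟨ ∑-cong xs fibres ⟨
      ∑ xs (λ x → ∑ zs (λ z → ∑ ys (λ y → [ (R? z ×-dec Q? y) ×-dec (x ≟X φ y z) ])))
        ≡⟨ ≡.trans (∑-comm xs zs _) (∑-cong zs (λ z → ∑-comm xs ys _)) ⟩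
      ∑ zs (λ z → ∑ ys (λ y → ∑ xs (λ x → [ (R? z ×-dec Q? y) ×-dec (x ≟X φ y z) ])))
        ≡⟨ ∑-cong zs (λ z → ≡.trans (∑-cong ys (λ y → fibre-size y z)) (≡.sym (*-distribˡ-∑ ys [ R? z ] (λ y → [ Q? y ])))) ⟩
      ∑ zs (λ z → [ R? z ] * ∑ ys (λ y → [ Q? y ]))
        ≡⟨ *-distribʳ-∑ zs (∑ ys (λ y → [ Q? y ])) (λ z → [ R? z ]) ⟨
      ∑ zs (λ z → [ R? z ]) * ∑ ys (λ y → [ Q? y ])
        ≡⟨ ≡.cong₂ _*_ (length-filter R? zs) (length-filter Q? ys) ⟨
      length (filter R? zs) * length (filter Q? ys) ∎
      where open ≡.≡-Reasoning

open Counting using (Enumeration; count-by-bijection)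

subsetEnumeration : (m : ℕ) → Enumeration (Subset m)
subsetEnumeration m = record
  { _≟ₑ_     = ≡-dec Bool._≟_
  ; elements = allSubsets m
  ; unique   = allSubsets-unique m
  ; complete = allSubsets-complete
  }

-- Points of 𝕏

infixr 5 _◃_
_◃_ : {n : ℕ} {u : Fin (suc n) → ℕ} → Fin (u zero) → Pt (u ∘ suc) → Pt u
(i ◃ q) zero    = i
(i ◃ q) (suc a) = q a

module _ {n : ℕ} {u : Fin n → ℕ} where

  -- Points are functions, so allPts u only lists them up to pointwise equality.
  infix 4 _≋_
  _≋_ : Pt u → Pt u → Set
  x ≋ y = ∀ a → x a ≡ y a

  coordEq-cong : {x x′ y y′ : Pt u} → x ≋ x′ → y ≋ y′ → ∀ a → coordEq x y a ≡ coordEq x′ y′ a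
  coordEq-cong x≋x′ y≋y′ a = ≡.cong₂ (λ i j → does (i ≟ j)) (x≋x′ a) (y≋y′ a)

  coordEq-sym : (x y : Pt u) (a : Fin n) → coordEq x y a ≡ coordEq y x a
  coordEq-sym x y a = does-⇔ (mk⇔ ≡.sym ≡.sym) (x a ≟ y a) (y a ≟ x a)

  ptEq-cong : {x x′ y y′ : Pt u} → x ≋ x′ → y ≋ y′ → ptEq x y ≡ ptEq x′ y′
  ptEq-cong x≋x′ y≋y′ = all-cong (coordEq-cong x≋x′ y≋y′) (allFin n)

  ptEq-sym : (x y : Pt u) → ptEq x y ≡ ptEq y x
  ptEq-sym x y = all-cong (coordEq-sym x y) (allFin n)

  inR-cong : (g : Fin (2 ^ n)) {x x′ y y′ : Pt u} → x ≋ x′ → y ≋ y′ → inR g x y ≡ inR g x′ y′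
  inR-cong g x≋x′ y≋y′ = all-cong (λ a → ≡.cong (λ p → boolEq (not p) (bit g a)) (coordEq-cong x≋x′ y≋y′ a)) (allFin n)

allPts-complete : {n : ℕ} (u : Fin n → ℕ) (x : Pt u) → Σ (Pt u) λ y → y ∈ˡ allPts u × x ≋ y
allPts-complete {zero}  u x = _ , here ≡.refl , λ ()
allPts-complete {suc n} u x with allPts-complete (u ∘ suc) (x ∘ suc)
... | y , y∈ , x≋y =
  _ , ∈-concatMap⁺ _ (Any.map (λ { ≡.refl → ∈-map⁺ _ y∈ }) (∈-allFin (x zero))) , λ { zero → ≡.refl ; (suc a) → x≋y a }

module PointSums {c ℓ : Level} (S : CommutativeSemiring c ℓ) where
  open CommutativeSemiring S hiding (zero)
  open FiniteSums S
  open import Relation.Binary.Reasoning.Setoid setoid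

  Respects≋ : {n : ℕ} {u : Fin n → ℕ} → (Pt u → Carrier) → Set ℓ
  Respects≋ {u = u} F = {w w′ : Pt u} → w ≋ w′ → F w ≈ F w′

  ∑-allPts-suc : {n : ℕ} (u : Fin (suc n) → ℕ) (F : Pt u → Carrier) → Respects≋ F →
                 ∑ (allPts u) F ≈ ∑ (allFin (u zero)) (λ i → ∑ (allPts (u ∘ suc)) (λ q → F (i ◃ q)))
  ∑-allPts-suc u F resp = trans (∑-concatMap _ (allFin (u zero)) F)
    (∑-cong (allFin (u zero)) (λ i → trans (reflexive (∑-map _ (allPts (u ∘ suc)) F))
      (∑-cong (allPts (u ∘ suc)) (λ q → resp (λ { zero → ≡.refl ; (suc a) → ≡.refl })))))

  ∑-δ-allPts : {n : ℕ} (u : Fin n → ℕ) (x : Pt u) (F : Pt u → Carrier) → Respects≋ F →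
               ∑ (allPts u) (λ w → 𝟙 (ptEq x w) * F w) ≈ F x
  ∑-δ-allPts {zero}  u x F resp = trans (+-identityʳ _) (trans (*-identityˡ _) (resp (λ ())))
  ∑-δ-allPts {suc n} u x F resp = begin
    ∑ (allPts u) (λ w → 𝟙 (ptEq x w) * F w)
      ≈⟨ ∑-allPts-suc u _ (λ w≋w′ → *-cong (reflexive (≡.cong 𝟙 (ptEq-cong {x = x} (λ _ → ≡.refl) w≋w′))) (resp w≋w′)) ⟩
    ∑ (allFin (u zero)) (λ i → ∑ (allPts u′) (λ q → 𝟙 (ptEq x (i ◃ q)) * F (i ◃ q)))
      ≈⟨ ∑-cong (allFin (u zero)) (λ i → ∑-cong (allPts u′) (λ q →
           trans (*-congʳ (trans (reflexive (≡.cong 𝟙 (all-allFin-suc (coordEq x (i ◃ q))))) (𝟙-∧ _ _))) (*-assoc _ _ _))) ⟩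
    ∑ (allFin (u zero)) (λ i → ∑ (allPts u′) (λ q → 𝟙 (does (x zero ≟ i)) * (𝟙 (ptEq x′ q) * F (i ◃ q))))
      ≈⟨ ∑-cong (allFin (u zero)) (λ i → *-distribˡ-∑ (allPts u′) _ _) ⟨
    ∑ (allFin (u zero)) (λ i → 𝟙 (does (x zero ≟ i)) * ∑ (allPts u′) (λ q → 𝟙 (ptEq x′ q) * F (i ◃ q)))
      ≈⟨ ∑-cong (allFin (u zero)) (λ i →
           *-congˡ (∑-δ-allPts u′ x′ (F ∘ (i ◃_)) (λ q≋q′ → resp λ { zero → ≡.refl ; (suc a) → q≋q′ a }))) ⟩
    ∑ (allFin (u zero)) (λ i → 𝟙 (does (x zero ≟ i)) * F (i ◃ x′))
      ≈⟨ ∑-δˡ _≟_ (λ i → F (i ◃ x′)) (allFin⁺ (u zero)) (∈-allFin (x zero)) ⟩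
    F (x zero ◃ x′)
      ≈⟨ resp (λ { zero → ≡.refl ; (suc a) → ≡.refl }) ⟩
    F x ∎
    where
    u′ = u ∘ suc
    x′ = x ∘ suc

  ∑-∏-allPts : {n : ℕ} (u : Fin n → ℕ) (h : (a : Fin n) → Fin (u a) → Carrier) →
               ∑ (allPts u) (λ w → ∏ (λ a → h a (w a))) ≈ ∏ (λ a → ∑ (allFin (u a)) (h a))
  ∑-∏-allPts {zero}  u h = +-identityʳ _
  ∑-∏-allPts {suc n} u h = begin
    ∑ (allPts u) (λ w → ∏ (λ a → h a (w a)))
      ≈⟨ ∑-allPts-suc u _ (λ w≋w′ → ∏-cong (λ a → reflexive (≡.cong (h a) (w≋w′ a)))) ⟩
    ∑ (allFin (u zero)) (λ i → ∑ (allPts (u ∘ suc)) (λ q → h zero i * ∏ (λ a → h (suc a) (q a))))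
      ≈⟨ ∑-cong (allFin (u zero)) (λ i → *-distribˡ-∑ (allPts (u ∘ suc)) _ _) ⟨
    ∑ (allFin (u zero)) (λ i → h zero i * ∑ (allPts (u ∘ suc)) (λ q → ∏ (λ a → h (suc a) (q a))))
      ≈⟨ ∑-cong (allFin (u zero)) (λ i → *-congˡ (∑-∏-allPts (u ∘ suc) (h ∘ suc))) ⟩
    ∑ (allFin (u zero)) (λ i → h zero i * ∏ (λ a → ∑ (allFin (u (suc a))) (h (suc a))))
      ≈⟨ *-distribʳ-∑ (allFin (u zero)) _ _ ⟨
    ∑ (allFin (u zero)) (h zero) * ∏ (λ a → ∑ (allFin (u (suc a))) (h (suc a))) ∎

-- Complex products

-- Triangle m p q r: some x, w, y in a set of size m have [x ≠ w] = p, [w ≠ y] = q and [x ≠ y] = r.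
data Triangle (m : ℕ) : Bool → Bool → Bool → Set where
  allEqual    : Triangle m false false false
  firstEqual  : Triangle m false true  true
  lastEqual   : Triangle m true  false true
  outerEqual  : Triangle m true  true  false
  allDistinct : 3 ≤ m → Triangle m true  true  true

module _ {m : ℕ} where

  _≢ᵇ_ : Fin m → Fin m → Bool
  i ≢ᵇ j = not (does (i ≟ j))

  triangle : (x w y : Fin m) → Triangle m (x ≢ᵇ w) (w ≢ᵇ y) (x ≢ᵇ y)
  triangle x w y with x ≟ w | w ≟ y | x ≟ y
  ... | yes ≡.refl | yes ≡.refl | yes _   = allEqual
  ... | yes ≡.refl | yes ≡.refl | no x≢x  = contradiction ≡.refl x≢x
  ... | yes ≡.refl | no w≢y     | yes x≡y = contradiction x≡y w≢y
  ... | yes ≡.refl | no _       | no _    = firstEqual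
  ... | no x≢w     | yes ≡.refl | yes x≡y = contradiction x≡y x≢w
  ... | no _       | yes ≡.refl | no _    = lastEqual
  ... | no x≢w     | no w≢y     | yes ≡.refl = outerEqual
  ... | no x≢w     | no w≢y     | no x≢y  = allDistinct (three-distinct x≢w w≢y x≢y)

  Realises : Fin m → Fin m → Fin m → Bool → Bool → Bool → Set
  Realises x w y p q r = (x ≢ᵇ w ≡ p) × (w ≢ᵇ y ≡ q) × (x ≢ᵇ y ≡ r)

  triangle-realised : 2 ≤ m → ∀ {p q r} → Triangle m p q r → Σ (Fin m × Fin m × Fin m) λ (x , w , y) → Realises x w y p q r
  triangle-realised (s≤s (s≤s _)) allEqual    = (zero , zero , zero) , ≡.refl , ≡.refl , ≡.refl
  triangle-realised (s≤s (s≤s _)) firstEqual  = (zero , zero , suc zero) , ≡.refl , ≡.refl , ≡.refl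
  triangle-realised (s≤s (s≤s _)) lastEqual   = (zero , suc zero , suc zero) , ≡.refl , ≡.refl , ≡.refl
  triangle-realised (s≤s (s≤s _)) outerEqual  = (zero , suc zero , zero) , ≡.refl , ≡.refl , ≡.refl
  triangle-realised (s≤s (s≤s _)) (allDistinct (s≤s (s≤s (s≤s _)))) = (zero , suc zero , suc (suc zero)) , ≡.refl , ≡.refl , ≡.refl

triangle-subst : {m : ℕ} {p p′ q q′ r r′ : Bool} → p ≡ p′ → q ≡ q′ → r ≡ r′ → Triangle m p q r → Triangle m p′ q′ r′
triangle-subst ≡.refl ≡.refl ≡.refl t = t

module _ {n : ℕ} (u : Fin n → ℕ) where

  -- The coordinatewise form of p^r_{bc} > 0, see ∈-cprod.
  Feasible : Fin (2 ^ n) → Fin (2 ^ n) → Fin (2 ^ n) → Set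
  Feasible b c r = ∀ a → Triangle (u a) (bit b a) (bit c a) (bit r a)

  private
    inR-bits : ∀ g (x y : Pt u) → T (inR g x y) ⇔ (∀ a → x a ≢ᵇ y a ≡ bit g a)
    inR-bits g x y = mk⇔ (λ inR-g a → Equivalence.to T-boolEq (Equivalence.to (T-all-allFin _) inR-g a))
                         (λ bits → Equivalence.from (T-all-allFin _) (λ a → Equivalence.from T-boolEq (bits a)))

  feasible-sound : ∀ {b c r} (x w y : Pt u) → T (inR b x w) → T (inR c w y) → T (inR r x y) → Feasible b c r
  feasible-sound {b} {c} {r} x w y bxw cwy rxy a =
    triangle-subst (Equivalence.to (inR-bits b x w) bxw a) (Equivalence.to (inR-bits c w y) cwy a) (Equivalence.to (inR-bits r x y) rxy a)
                   (triangle (x a) (w a) (y a))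

  feasible-complete : (∀ a → 2 ≤ u a) → ∀ {b c r} → Feasible b c r →
                      Σ (Pt u × Pt u × Pt u) λ (x , w , y) → T (inR b x w) × T (inR c w y) × T (inR r x y)
  feasible-complete u≥2 {b} {c} {r} feasible =
    (x , w , y) , Equivalence.from (inR-bits b x w) (λ a → proj₁ (realised a))
                , Equivalence.from (inR-bits c w y) (λ a → proj₁ (proj₂ (realised a)))
                , Equivalence.from (inR-bits r x y) (λ a → proj₂ (proj₂ (realised a)))
    where
    xwy : ∀ a → _
    xwy a = triangle-realised (u≥2 a) (feasible a)
    x w y : Pt u
    x a = proj₁ (proj₁ (xwy a))
    w a = proj₁ (proj₂ (proj₁ (xwy a)))
    y a = proj₂ (proj₂ (proj₁ (xwy a)))
    realised : ∀ a → Realises (x a) (w a) (y a) (bit b a) (bit c a) (bit r a)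
    realised a = proj₂ (xwy a)

positive-filterᵇ : {A : Set} (p : A → Bool) (xs : List A) → T (0 <ᵇ length (filterᵇ p xs)) ⇔ Any (T ∘ p) xs
positive-filterᵇ p []       = mk⇔ (λ ()) (λ ())
positive-filterᵇ p (x ∷ xs) with p x in px
... | true  = mk⇔ (λ _ → here (≡.subst T (≡.sym px) tt)) (λ _ → tt)
... | false = mk⇔ (there ∘ Equivalence.to (positive-filterᵇ p xs)) λ
  { (here px-holds) → ⊥-elim (≡.subst T px px-holds)
  ; (there pxs)     → Equivalence.from (positive-filterᵇ p xs) pxs }

module _ {n : ℕ} (u : Fin n → ℕ) (u≥2 : ∀ a → 2 ≤ u a) where

  private
    Pts = allPts u

    Witnessed : Fin (2 ^ n) → Fin (2 ^ n) → Fin (2 ^ n) → Bool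
    Witnessed b c r = any (λ x → any (λ y → inR r x y ∧ (0 <ᵇ pcount u b c x y)) Pts) Pts

    witnessed⇔feasible : ∀ {b c r} → T (Witnessed b c r) ⇔ Feasible u b c r
    witnessed⇔feasible {b} {c} {r} = mk⇔ to from
      where
      to : T (Witnessed b c r) → Feasible u b c r
      to witnessed with Any.satisfied (any⁻ _ Pts witnessed)
      ... | x , x-ok with Any.satisfied (any⁻ _ Pts x-ok)
      ... | y , xy-ok with Equivalence.to T-∧ xy-ok
      ... | rxy , positive with Any.satisfied (Equivalence.to (positive-filterᵇ _ Pts) positive)
      ... | w , xwy-ok = feasible-sound u x w y (proj₁ (Equivalence.to T-∧ xwy-ok)) (proj₂ (Equivalence.to T-∧ xwy-ok)) rxy
      from : Feasible u b c r → T (Witnessed b c r)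
      from feasible with feasible-complete u u≥2 feasible
      ... | (x , w , y) , bxw , cwy , rxy with allPts-complete u x | allPts-complete u w | allPts-complete u y
      ... | x′ , x′∈ , x≋x′ | w′ , w′∈ , w≋w′ | y′ , y′∈ , y≋y′ =
        any⁺ _ (lose x′∈ (any⁺ _ (lose y′∈ (Equivalence.from T-∧
          (transport r x≋x′ y≋y′ rxy , Equivalence.from (positive-filterᵇ _ Pts)
            (lose w′∈ (Equivalence.from T-∧ (transport b x≋x′ w≋w′ bxw , transport c w≋w′ y≋y′ cwy))))))))
        where
        transport : ∀ g {s s′ t t′} → s ≋ s′ → t ≋ t′ → T (inR g s t) → T (inR g s′ t′)
        transport g s≋s′ t≋t′ = ≡.subst T (inR-cong g s≋s′ t≋t′)

  ∈-cprod : ∀ {A B r} → r ∈ cprod u A B ⇔ ∃ λ b → ∃ λ c → b ∈ A × c ∈ B × Feasible u b c r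
  ∈-cprod {A} {B} {r} = mk⇔ to from
    where
    to : r ∈ cprod u A B → ∃ λ b → ∃ λ c → b ∈ A × c ∈ B × Feasible u b c r
    to r∈ with Any.satisfied (any⁻ _ (allFin (2 ^ n)) (Equivalence.to ∈-tabulate r∈))
    ... | b , b-ok with Any.satisfied (any⁻ _ (allFin (2 ^ n)) b-ok)
    ... | c , bc-ok with Equivalence.to T-∧ bc-ok
    ... | b∈A , c-ok with Equivalence.to T-∧ c-ok
    ... | c∈B , witnessed = b , c , Equivalence.from ∈⇔T-lookup b∈A , Equivalence.from ∈⇔T-lookup c∈B , Equivalence.to witnessed⇔feasible witnessed
    from : (∃ λ b → ∃ λ c → b ∈ A × c ∈ B × Feasible u b c r) → r ∈ cprod u A B
    from (b , c , b∈A , c∈B , feasible) = Equivalence.from ∈-tabulate (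
      (any⁺ _ (lose (∈-allFin b) (any⁺ _ (lose (∈-allFin c)
        (Equivalence.from T-∧ (Equivalence.to ∈⇔T-lookup b∈A ,
          Equivalence.from T-∧ (Equivalence.to ∈⇔T-lookup c∈B , Equivalence.from witnessed⇔feasible feasible))))))))

module _ {m : ℕ} where

  triangle-same : ∀ {p r} → (T r → T p × 3 ≤ m) → Triangle m p p r
  triangle-same {false} {false} _ = allEqual
  triangle-same {true}  {false} _ = outerEqual
  triangle-same {false} {true}  h = ⊥-elim (proj₁ (h tt))
  triangle-same {true}  {true}  h = allDistinct (proj₂ (h tt))

  triangle-xor : ∀ p q → Triangle m p q (p xor q)
  triangle-xor false false = allEqual
  triangle-xor false true  = firstEqual
  triangle-xor true  false = lastEqual
  triangle-xor true  true  = outerEqual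

  triangle-∨ : ∀ {p q} → (T p → T q → 3 ≤ m) → Triangle m p q (p ∨ q)
  triangle-∨ {true} {true} h = allDistinct (h tt tt)
  triangle-∨ {true} {false} _ = lastEqual
  triangle-∨ {false} {q} _ = triangle-xor false q

  triangle-small : ∀ {p q r} → ¬ 3 ≤ m → Triangle m p q r → r ≡ p xor q
  triangle-small _ allEqual         = ≡.refl
  triangle-small _ firstEqual       = ≡.refl
  triangle-small _ lastEqual        = ≡.refl
  triangle-small _ outerEqual       = ≡.refl
  triangle-small ¬3≤ (allDistinct 3≤) = contradiction 3≤ ¬3≤

  triangle-∨⁻ : ∀ {p q} → Triangle m p q true → T (p ∨ q)
  triangle-∨⁻ firstEqual      = tt
  triangle-∨⁻ lastEqual       = tt
  triangle-∨⁻ (allDistinct _) = tt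

-- Closed and strongly normal subsets

module _ {n : ℕ} (u : Fin n → ℕ) where

  IsClosed : Subset (2 ^ n) → Set
  IsClosed A = (∃ λ g → g ∈ A) × (∀ {b c r} → b ∈ A → c ∈ A → Feasible u b c r → r ∈ A)

  IsStronglyNormal : Subset (2 ^ n) → Set
  IsStronglyNormal A = IsClosed A × (∀ {g h b r} → h ∈ A → Feasible u g h b → Feasible u b g r → r ∈ A)

module _ {n : ℕ} {u : Fin n → ℕ} (u≥2 : ∀ a → 2 ≤ u a) {A : Subset (2 ^ n)} where

  closed⇔ : Closed u A ⇔ IsClosed u A
  closed⇔ = mk⇔ (λ (nonempty , AA⊆A) → nonempty , λ b∈ c∈ feasible → AA⊆A (Equivalence.from (∈-cprod u u≥2) (_ , _ , b∈ , c∈ , feasible)))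
                (λ (nonempty , closed) → nonempty , λ r∈ →
                  let (b , c , b∈ , c∈ , feasible) = Equivalence.to (∈-cprod u u≥2) r∈ in closed b∈ c∈ feasible)

  stronglyNormal⇔ : StronglyNormal u A ⇔ IsStronglyNormal u A
  stronglyNormal⇔ = mk⇔ to from
    where
    to : StronglyNormal u A → IsStronglyNormal u A
    to (closed , normal) = Equivalence.to closed⇔ closed , λ {g} h∈ ghb bgr →
      normal g (Equivalence.from (∈-cprod u u≥2) (_ , _ , Equivalence.from (∈-cprod u u≥2) (_ , _ , x∈⁅x⁆ g , h∈ , ghb) , x∈⁅x⁆ g , bgr))
    from : IsStronglyNormal u A → StronglyNormal u A
    from (closed , normal) = Equivalence.from closed⇔ closed , λ g r∈ →
      let (b , c , b∈ , c∈ , bcr) = Equivalence.to (∈-cprod u u≥2) r∈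
          (g′ , h , g′∈ , h∈ , g′hb) = Equivalence.to (∈-cprod u u≥2) b∈
      in normal h∈ (≡.subst (λ k → Feasible u k h b) (x∈⁅y⁆⇒x≡y g g′∈) g′hb)
                   (≡.subst (λ k → Feasible u b k _) (x∈⁅y⁆⇒x≡y g c∈) bcr)

module ClosedSubsets {n : ℕ} (u : Fin n → ℕ) where

  Shape : Set
  Shape = Fin n → Bool

  infix 4 _∈ˢ_
  _∈ˢ_ : Shape → Subset (2 ^ n) → Set
  f ∈ˢ A = encode f ∈ A

  ∈ˢ-cong : {f f′ : Shape} → (∀ a → f a ≡ f′ a) → ∀ {A} → f ∈ˢ A → f′ ∈ˢ A
  ∈ˢ-cong f≗f′ = ≡.subst (_∈ _) (encode-cong f≗f′)

  bit-∈ˢ : ∀ {g : Fin (2 ^ n)} {A} → bit {n} g ∈ˢ A ⇔ g ∈ A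
  bit-∈ˢ {g} = mk⇔ (≡.subst (_∈ _) (encode-bit {n} g)) (≡.subst (_∈ _) (≡.sym (encode-bit {n} g)))

  large : Fin n → Bool
  large a = does (3 ≤? u a)

  T-large : ∀ {a} → T (large a) ⇔ 3 ≤ u a
  T-large {a} = T-does (3 ≤? u a)

  zeroˢ : Shape
  zeroˢ _ = false

  singletonˢ : Fin n → Shape
  singletonˢ a₀ a = does (a ≟ a₀)

  smallPart largePart : Shape → Shape
  smallPart f a = f a ∧ not (large a)
  largePart f a = f a ∧ large a

  FeasibleShapes : Shape → Shape → Shape → Set
  FeasibleShapes f g h = ∀ a → Triangle (u a) (f a) (g a) (h a)

  LargeBitsIn : Fin (2 ^ n) → Subset n → Set
  LargeBitsIn g D = ∀ a → T (bit g a) → 3 ≤ u a → a ∈ D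

  largeSupport : Subset (2 ^ n) → Subset n
  largeSupport A = ⟦ (λ a → (3 ≤? u a) ×-dec Fin.any? (λ g → (g ∈? A) ×-dec T? (bit g a))) ⟧

  ∈-largeSupport : ∀ {A a} → a ∈ largeSupport A ⇔ (3 ≤ u a × ∃ λ g → g ∈ A × T (bit g a))
  ∈-largeSupport {A} = ∈⟦⟧ (λ a → (3 ≤? u a) ×-dec Fin.any? (λ g → (g ∈? A) ×-dec T? (bit g a)))

  saturation : Subset (2 ^ n) → Subset (2 ^ n)
  saturation A = ⟦ (λ g → encode (smallPart (bit g)) ∈? A) ⟧

  ∈-saturation : ∀ {A g} → g ∈ saturation A ⇔ smallPart (bit g) ∈ˢ A
  ∈-saturation {A} = ∈⟦⟧ (λ g → encode (smallPart (bit g)) ∈? A)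

  restriction : Subset (2 ^ n) → Subset n → Subset (2 ^ n)
  restriction A D = ⟦ (λ g → (g ∈? A) ×-dec Fin.all? (λ a → T? (bit g a) →-dec ((3 ≤? u a) →-dec (a ∈? D)))) ⟧

  ∈-restriction : ∀ {A D g} → g ∈ restriction A D ⇔ (g ∈ A × LargeBitsIn g D)
  ∈-restriction {A} {D} = ∈⟦⟧ (λ g → (g ∈? A) ×-dec Fin.all? (λ a → T? (bit g a) →-dec ((3 ≤? u a) →-dec (a ∈? D))))

  module Closed {A : Subset (2 ^ n)} (A-closed : IsClosed u A) where

    closedˢ : ∀ {f g h} → f ∈ˢ A → g ∈ˢ A → FeasibleShapes f g h → h ∈ˢ A
    closedˢ {f} {g} {h} f∈ g∈ feasible = proj₂ A-closed f∈ g∈ λ a →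
      triangle-subst (≡.sym (bit-encode f a)) (≡.sym (bit-encode g a)) (≡.sym (bit-encode h a)) (feasible a)

    largeSubshape∈ : ∀ {f h} → f ∈ˢ A → (∀ a → T (h a) → T (f a) × 3 ≤ u a) → h ∈ˢ A
    largeSubshape∈ f∈ h⊆f = closedˢ f∈ f∈ (λ a → triangle-same (h⊆f a))

    zero∈ : zeroˢ ∈ˢ A
    zero∈ = largeSubshape∈ (Equivalence.from bit-∈ˢ (proj₂ (proj₁ A-closed))) (λ a ())

    xor∈ : ∀ {f g} → f ∈ˢ A → g ∈ˢ A → (λ a → f a xor g a) ∈ˢ A
    xor∈ f∈ g∈ = closedˢ f∈ g∈ (λ a → triangle-xor _ _)

    ∨∈ : ∀ {f g} → f ∈ˢ A → g ∈ˢ A → (∀ a → T (f a) → T (g a) → 3 ≤ u a) → (λ a → f a ∨ g a) ∈ˢ A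
    ∨∈ f∈ g∈ shared = closedˢ f∈ g∈ (λ a → triangle-∨ (shared a))

    smallPart∈ : ∀ {f} → f ∈ˢ A → smallPart f ∈ˢ A
    smallPart∈ {f} f∈ = ∈ˢ-cong (λ a → xor-∧ (f a) (large a)) (xor∈ f∈ (largeSubshape∈ f∈ largePart⊆f))
      where
      largePart⊆f : ∀ a → T (largePart f a) → T (f a) × 3 ≤ u a
      largePart⊆f a t = let (fa , la) = Equivalence.to T-∧ t in fa , Equivalence.to T-large la
      xor-∧ : ∀ p l → p xor (p ∧ l) ≡ p ∧ not l
      xor-∧ true  true  = ≡.refl
      xor-∧ true  false = ≡.refl
      xor-∧ false l     = ≡.refl

    reassemble : ∀ {f} → smallPart f ∈ˢ A → largePart f ∈ˢ A → f ∈ˢ A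
    reassemble {f} small∈ large∈ = ∈ˢ-cong (λ a → split (f a) (large a)) (∨∈ small∈ large∈ disjoint)
      where
      split : ∀ p l → (p ∧ not l) ∨ (p ∧ l) ≡ p
      split true  true  = ≡.refl
      split true  false = ≡.refl
      split false l     = ≡.refl
      disjoint : ∀ a → T (smallPart f a) → T (largePart f a) → 3 ≤ u a
      disjoint a s l with large a
      ... | true  = ⊥-elim (proj₂ (Equivalence.to T-∧ s))
      ... | false = ⊥-elim (proj₂ (Equivalence.to T-∧ l))

    largeShape∈ : ∀ {h} → (∀ a → T (h a) → 3 ≤ u a × singletonˢ a ∈ˢ A) → h ∈ˢ A
    largeShape∈ {h} singletons∈ = ∈ˢ-cong everywhere (restricted (allFin n))
      where
      listed : List (Fin n) → Shape
      listed as a = any (λ b → does (a ≟ b)) as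
      everywhere : ∀ a → h a ∧ listed (allFin n) a ≡ h a
      everywhere a = ≡.trans (≡.cong (h a ∧_) (Equivalence.to T-≡ (any⁺ _ (lose (∈-allFin a) (Equivalence.from T-≡ (dec-true (a ≟ a) ≡.refl))))))
                             (∧-identityʳ (h a))
      restricted : (as : List (Fin n)) → (λ a → h a ∧ listed as a) ∈ˢ A
      restricted []       = ∈ˢ-cong (λ a → ≡.sym (∧-zeroʳ (h a))) zero∈
      restricted (b ∷ bs) with h b in hb
      ... | true  = ∈ˢ-cong added (∨∈ (restricted bs) (proj₂ (singletons∈ b (Equivalence.from T-≡ hb))) shared)
        where
        added : ∀ a → (h a ∧ listed bs a) ∨ does (a ≟ b) ≡ h a ∧ (does (a ≟ b) ∨ listed bs a)
        added a with a ≟ b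
        ... | yes ≡.refl = ≡.trans (∨-zeroʳ _) (≡.sym (≡.trans (∧-identityʳ (h a)) hb))
        ... | no  _      = ∨-identityʳ _
        shared : ∀ a → T (h a ∧ listed bs a) → T (does (a ≟ b)) → 3 ≤ u a
        shared a _ a≡b with a ≟ b
        ... | yes ≡.refl = proj₁ (singletons∈ b (Equivalence.from T-≡ hb))
      ... | false = ∈ˢ-cong skipped (restricted bs)
        where
        skipped : ∀ a → h a ∧ listed bs a ≡ h a ∧ (does (a ≟ b) ∨ listed bs a)
        skipped a with a ≟ b
        ... | yes ≡.refl = ≡.trans (≡.cong (_∧ listed bs a) hb) (≡.cong (_∧ (true ∨ listed bs a)) (≡.sym hb))
        ... | no  _      = ≡.refl

    support-singleton∈ : ∀ {a} → a ∈ largeSupport A → singletonˢ a ∈ˢ A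
    support-singleton∈ {a} a∈ with Equivalence.to ∈-largeSupport a∈
    ... | 3≤ , g , g∈A , g-a = largeSubshape∈ (Equivalence.from bit-∈ˢ g∈A) at-a
      where
      at-a : ∀ a′ → T (singletonˢ a a′) → T (bit g a′) × 3 ≤ u a′
      at-a a′ t with a′ ≟ a
      ... | yes ≡.refl = g-a , 3≤

    ∈⇔parts : ∀ {g} → g ∈ A ⇔ (smallPart (bit g) ∈ˢ A × LargeBitsIn g (largeSupport A))
    ∈⇔parts {g} = mk⇔ (λ g∈ → smallPart∈ (Equivalence.from bit-∈ˢ g∈) , λ a g-a 3≤ → Equivalence.from ∈-largeSupport (3≤ , g , g∈ , g-a))
                 (λ (small∈ , large⊆) → Equivalence.to bit-∈ˢ (reassemble small∈ (largeShape∈ λ a t →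
                   let (g-a , la) = Equivalence.to T-∧ t
                       3≤ = Equivalence.to T-large la
                   in 3≤ , support-singleton∈ (large⊆ a g-a 3≤))))

    restriction-saturation : restriction (saturation A) (largeSupport A) ≡ A
    restriction-saturation = ⊆-antisym
      (λ g∈ → let (g∈sat , large⊆) = Equivalence.to ∈-restriction g∈ in Equivalence.from ∈⇔parts (Equivalence.to ∈-saturation g∈sat , large⊆))
      (λ g∈ → let (small∈ , large⊆) = Equivalence.to ∈⇔parts g∈ in Equivalence.from ∈-restriction (Equivalence.from ∈-saturation small∈ , large⊆))

    largeSupport-⊆ : largeSupport A ⊆ Large u
    largeSupport-⊆ a∈ = Equivalence.from (∈-Large {u = u}) (proj₁ (Equivalence.to ∈-largeSupport a∈))

    private
      smallPart-feasible : ∀ {b c r} → Feasible u b c r → ∀ a → smallPart (bit r) a ≡ smallPart (bit b) a xor smallPart (bit c) a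
      smallPart-feasible {b} {c} {r} feasible a with large a in la
      ... | true  = ≡.trans (∧-zeroʳ _) (≡.sym (≡.cong₂ _xor_ (∧-zeroʳ (bit b a)) (∧-zeroʳ (bit c a))))
      ... | false = ≡.trans (∧-identityʳ _) (≡.trans (triangle-small small (feasible a))
                      (≡.sym (≡.cong₂ _xor_ (∧-identityʳ (bit b a)) (∧-identityʳ (bit c a)))))
        where
        small : ¬ 3 ≤ u a
        small 3≤ = ≡.subst T la (Equivalence.from T-large 3≤)

      xor-cancel : ∀ p q → (p xor q) xor p ≡ q
      xor-cancel true  true  = ≡.refl
      xor-cancel true  false = ≡.refl
      xor-cancel false q     = xor-identityʳ q

    saturation-stronglyNormal : IsStronglyNormal u (saturation A)
    saturation-stronglyNormal = (nonempty , closed) , normal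
      where
      nonempty : ∃ λ g → g ∈ saturation A
      nonempty = encode zeroˢ , Equivalence.from ∈-saturation (∈ˢ-cong (λ a → ≡.cong (_∧ _) (≡.sym (bit-encode zeroˢ a))) zero∈)
      closed : ∀ {b c r} → b ∈ saturation A → c ∈ saturation A → Feasible u b c r → r ∈ saturation A
      closed b∈ c∈ feasible = Equivalence.from ∈-saturation
        (∈ˢ-cong (≡.sym ∘ smallPart-feasible feasible) (xor∈ (Equivalence.to ∈-saturation b∈) (Equivalence.to ∈-saturation c∈)))
      normal : ∀ {g h b r} → h ∈ saturation A → Feasible u g h b → Feasible u b g r → r ∈ saturation A
      normal {g} {h} {b} {r} h∈ ghb bgr = Equivalence.from ∈-saturation (∈ˢ-cong same-small (Equivalence.to ∈-saturation h∈))
        where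
        small : Fin (2 ^ n) → Shape
        small k = smallPart (bit k)
        same-small : ∀ a → small h a ≡ small r a
        same-small a = ≡.sym (begin
          small r a                       ≡⟨ smallPart-feasible bgr a ⟩
          small b a xor small g a         ≡⟨ ≡.cong (_xor small g a) (smallPart-feasible ghb a) ⟩
          (small g a xor small h a) xor small g a ≡⟨ xor-cancel (small g a) (small h a) ⟩
          small h a                       ∎)
          where open ≡.≡-Reasoning

  restriction-closed : ∀ {A D} → IsClosed u A → IsClosed u (restriction A D)
  restriction-closed {A} {D} (A-nonempty , A-closed) = nonempty , closed
    where
    open Closed (A-nonempty , A-closed) using (zero∈)
    nonempty : ∃ λ g → g ∈ restriction A D
    nonempty = encode zeroˢ , Equivalence.from ∈-restriction (zero∈ , λ a t _ → ⊥-elim (≡.subst T (bit-encode zeroˢ a) t))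
    closed : ∀ {b c r} → b ∈ restriction A D → c ∈ restriction A D → Feasible u b c r → r ∈ restriction A D
    closed b∈ c∈ feasible =
      let (b∈A , b-large) = Equivalence.to ∈-restriction b∈
          (c∈A , c-large) = Equivalence.to ∈-restriction c∈
      in Equivalence.from ∈-restriction (A-closed b∈A c∈A feasible , λ a r-a 3≤ →
           [ (λ b-a → b-large a b-a 3≤) , (λ c-a → c-large a c-a 3≤) ]′
             (Equivalence.to T-∨ (triangle-∨⁻ (triangle-subst ≡.refl ≡.refl (Equivalence.to T-≡ r-a) (feasible a)))))

  module StronglyNormal {A : Subset (2 ^ n)} (A-normal : IsStronglyNormal u A) where
    open Closed (proj₁ A-normal)

    large-singleton∈ : ∀ {a} → 3 ≤ u a → singletonˢ a ∈ˢ A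
    large-singleton∈ {a} 3≤ = proj₂ A-normal zero∈ (λ a′ → on-codes (triangle-subst ≡.refl ≡.refl (xor-identityʳ _) (triangle-xor _ false)))
                                              (λ a′ → on-codes (triangle-same (λ t → t , at-a a′ t)))
      where
      on-codes : ∀ {a′ f g h} → Triangle (u a′) (f a′) (g a′) (h a′) →
                 Triangle (u a′) (bit (encode f) a′) (bit (encode g) a′) (bit (encode h) a′)
      on-codes {a′} {f} {g} {h} = triangle-subst (≡.sym (bit-encode f a′)) (≡.sym (bit-encode g a′)) (≡.sym (bit-encode h a′))
      at-a : ∀ a′ → T (singletonˢ a a′) → 3 ≤ u a′
      at-a a′ t with a′ ≟ a
      ... | yes ≡.refl = 3≤

    smallPart⇔ : ∀ {f} → f ∈ˢ A ⇔ smallPart f ∈ˢ A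
    smallPart⇔ = mk⇔ smallPart∈ (λ small∈ → reassemble small∈ (largeShape∈ λ a t →
      let 3≤ = Equivalence.to T-large (proj₂ (Equivalence.to T-∧ t)) in 3≤ , large-singleton∈ 3≤))

    saturation-restriction : ∀ {D} → saturation (restriction A D) ≡ A
    saturation-restriction {D} = ⊆-antisym
      (λ {g} g∈ → Equivalence.to bit-∈ˢ (Equivalence.from smallPart⇔ (proj₁ (Equivalence.to ∈-restriction (Equivalence.to ∈-saturation g∈)))))
      (λ {g} g∈ → Equivalence.from ∈-saturation (Equivalence.from ∈-restriction
        (Equivalence.to smallPart⇔ (Equivalence.from bit-∈ˢ g∈) , λ a t 3≤ → ⊥-elim (no-large g a t 3≤))))
      where
      no-large : ∀ g a → T (bit (encode (smallPart (bit g))) a) → 3 ≤ u a → ⊥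
      no-large g a t 3≤ = not-both (large a) (proj₂ (Equivalence.to T-∧ (≡.subst T (bit-encode _ a) t))) (Equivalence.from T-large 3≤)
        where
        not-both : ∀ p → T (not p) → T p → ⊥
        not-both true  () _
        not-both false _  ()

    largeSupport-restriction : ∀ {D} → D ⊆ Large u → largeSupport (restriction A D) ≡ D
    largeSupport-restriction {D} D⊆Large = ⊆-antisym
      (λ {a} a∈ → let (3≤ , g , g∈ , g-a) = Equivalence.to ∈-largeSupport a∈ in proj₂ (Equivalence.to ∈-restriction g∈) a g-a 3≤)
      (λ {a} a∈D → let 3≤ = Equivalence.to (∈-Large {u = u}) (D⊆Large a∈D) in
        Equivalence.from ∈-largeSupport (3≤ , encode (singletonˢ a) ,
          Equivalence.from ∈-restriction (large-singleton∈ 3≤ , only-a a∈D) ,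
          ≡.subst T (≡.sym (bit-encode (singletonˢ a) a)) (Equivalence.from T-≡ (dec-true (a ≟ a) ≡.refl))))
      where
      only-a : ∀ {a} → a ∈ D → LargeBitsIn (encode (singletonˢ a)) D
      only-a {a} a∈D a′ t _ with a′ ≟ a | ≡.subst T (bit-encode (singletonˢ a) a′) t
      ... | yes ≡.refl | _ = a∈D

-- Matrices on one coordinate

module CoordinateMatrices {c ℓ : Level} (R : CommutativeRing c ℓ) (m : ℕ) where
  open CommutativeRing R
  open FiniteSums commutativeSemiring
  open import Relation.Binary.Reasoning.Setoid setoid
  open import Algebra.Properties.CommutativeSemigroup *-commutativeSemigroup using (x∙yz≈y∙xz)

  CMat : Set c
  CMat = Fin m → Fin m → Carrier

  infix 4 _≈ᶜ_
  _≈ᶜ_ : CMat → CMat → Set ℓ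
  φ ≈ᶜ ψ = ∀ i j → φ i j ≈ ψ i j

  infixl 7 _⋆_
  _⋆_ : CMat → CMat → CMat
  (φ ⋆ ψ) i j = ∑ (allFin m) (λ k → φ i k * ψ k j)

  infixl 6 _+ᶜ_•_
  _+ᶜ_•_ : CMat → Carrier → CMat → CMat
  (φ +ᶜ k • ψ) i j = φ i j + k * ψ i j

  Iᶜ : CMat
  Iᶜ i j = 𝟙 (does (i ≟ j))

  ⋆-congˡ : {φ φ′ : CMat} (ψ : CMat) → φ ≈ᶜ φ′ → φ ⋆ ψ ≈ᶜ φ′ ⋆ ψ
  ⋆-congˡ ψ φ≈φ′ i j = ∑-cong (allFin m) (λ k → *-congʳ (φ≈φ′ i k))

  ⋆-congʳ : (φ : CMat) {ψ ψ′ : CMat} → ψ ≈ᶜ ψ′ → φ ⋆ ψ ≈ᶜ φ ⋆ ψ′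
  ⋆-congʳ φ ψ≈ψ′ i j = ∑-cong (allFin m) (λ k → *-congˡ (ψ≈ψ′ k j))

  ⋆-assoc : (φ ψ χ : CMat) → (φ ⋆ ψ) ⋆ χ ≈ᶜ φ ⋆ (ψ ⋆ χ)
  ⋆-assoc φ ψ χ i j = begin
    ∑ L (λ k → ∑ L (λ l → φ i l * ψ l k) * χ k j) ≈⟨ ∑-cong L (λ k → *-distribʳ-∑ L _ _) ⟩
    ∑ L (λ k → ∑ L (λ l → φ i l * ψ l k * χ k j)) ≈⟨ ∑-comm L L _ ⟩
    ∑ L (λ l → ∑ L (λ k → φ i l * ψ l k * χ k j)) ≈⟨ ∑-cong L (λ l → ∑-cong L (λ k → *-assoc _ _ _)) ⟩
    ∑ L (λ l → ∑ L (λ k → φ i l * (ψ l k * χ k j))) ≈⟨ ∑-cong L (λ l → *-distribˡ-∑ L _ _) ⟨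
    ∑ L (λ l → φ i l * ∑ L (λ k → ψ l k * χ k j)) ∎
    where L = allFin m

  ⋆-diagonalʳ : (φ : CMat) (d : Fin m → Carrier) (i j : Fin m) →
                ∑ (allFin m) (λ k → φ i k * (Iᶜ k j * d k)) ≈ φ i j * d j
  ⋆-diagonalʳ φ d i j = trans
    (∑-cong (allFin m) (λ k → x∙yz≈y∙xz _ _ _))
    (∑-δʳ _≟_ (λ k → φ i k * d k) (allFin⁺ m) (∈-allFin j))

  ⋆-diagonalˡ : (φ : CMat) (d : Fin m → Carrier) (i j : Fin m) →
                ∑ (allFin m) (λ k → (Iᶜ i k * d i) * φ k j) ≈ d i * φ i j
  ⋆-diagonalˡ φ d i j = trans (∑-cong (allFin m) (λ k → *-assoc _ _ _)) (∑-δˡ _≟_ (λ k → d i * φ k j) (allFin⁺ m) (∈-allFin i))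

  ⋆-identityˡ : (φ : CMat) → Iᶜ ⋆ φ ≈ᶜ φ
  ⋆-identityˡ φ i j = ∑-δˡ _≟_ (λ k → φ k j) (allFin⁺ m) (∈-allFin i)

  ⋆-identityʳ : (φ : CMat) → φ ⋆ Iᶜ ≈ᶜ φ
  ⋆-identityʳ φ i j = trans (∑-cong (allFin m) (λ k → *-comm _ _)) (∑-δʳ _≟_ (φ i) (allFin⁺ m) (∈-allFin j))

  ⋆-distribʳ : (φ ψ χ : CMat) (k : Carrier) → (φ +ᶜ k • ψ) ⋆ χ ≈ᶜ (φ ⋆ χ) +ᶜ k • (ψ ⋆ χ)
  ⋆-distribʳ φ ψ χ k i j = begin
    ∑ L (λ l → (φ i l + k * ψ i l) * χ l j)           ≈⟨ ∑-cong L (λ l → trans (distribʳ _ _ _) (+-congˡ (*-assoc _ _ _))) ⟩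
    ∑ L (λ l → φ i l * χ l j + k * (ψ i l * χ l j))   ≈⟨ ∑-distrib-+ L _ _ ⟩
    (φ ⋆ χ) i j + ∑ L (λ l → k * (ψ i l * χ l j))     ≈⟨ +-congˡ (*-distribˡ-∑ L _ _) ⟨
    (φ ⋆ χ) i j + k * (ψ ⋆ χ) i j                     ∎
    where L = allFin m

  ⋆-distribˡ : (φ ψ χ : CMat) (k : Carrier) → χ ⋆ (φ +ᶜ k • ψ) ≈ᶜ (χ ⋆ φ) +ᶜ k • (χ ⋆ ψ)
  ⋆-distribˡ φ ψ χ k i j = begin
    ∑ L (λ l → χ i l * (φ l j + k * ψ l j))           ≈⟨ ∑-cong L (λ l → trans (distribˡ _ _ _) (+-congˡ (x∙yz≈y∙xz _ _ _))) ⟩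
    ∑ L (λ l → χ i l * φ l j + k * (χ i l * ψ l j))   ≈⟨ ∑-distrib-+ L _ _ ⟩
    (χ ⋆ φ) i j + ∑ L (λ l → k * (χ i l * ψ l j))     ≈⟨ +-congˡ (*-distribˡ-∑ L _ _) ⟨
    (χ ⋆ φ) i j + k * (χ ⋆ ψ) i j                     ∎
    where L = allFin m

  Commutes : CMat → CMat → Set ℓ
  Commutes φ ψ = φ ⋆ ψ ≈ᶜ ψ ⋆ φ

  Iᶜ-commutes : (ψ : CMat) → Commutes Iᶜ ψ
  Iᶜ-commutes ψ i j = trans (⋆-identityˡ ψ i j) (sym (⋆-identityʳ ψ i j))

  commutes-Iᶜ : (φ : CMat) {ψ : CMat} → ψ ≈ᶜ Iᶜ → Commutes φ ψ
  commutes-Iᶜ φ {ψ} ψ≈I i j = begin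
    (φ ⋆ ψ) i j  ≈⟨ ⋆-congʳ φ ψ≈I i j ⟩
    (φ ⋆ Iᶜ) i j ≈⟨ Iᶜ-commutes φ i j ⟨
    (Iᶜ ⋆ φ) i j ≈⟨ ⋆-congˡ φ ψ≈I i j ⟨
    (ψ ⋆ φ) i j  ∎

  commutes-⋆ : {φ ψ χ : CMat} → Commutes φ ψ → Commutes φ χ → Commutes φ (ψ ⋆ χ)
  commutes-⋆ {φ} {ψ} {χ} φψ φχ i j = begin
    (φ ⋆ (ψ ⋆ χ)) i j ≈⟨ ⋆-assoc φ ψ χ i j ⟨
    ((φ ⋆ ψ) ⋆ χ) i j ≈⟨ ⋆-congˡ χ φψ i j ⟩
    ((ψ ⋆ φ) ⋆ χ) i j ≈⟨ ⋆-assoc ψ φ χ i j ⟩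
    (ψ ⋆ (φ ⋆ χ)) i j ≈⟨ ⋆-congʳ ψ φχ i j ⟩
    (ψ ⋆ (χ ⋆ φ)) i j ≈⟨ ⋆-assoc ψ χ φ i j ⟨
    ((ψ ⋆ χ) ⋆ φ) i j ∎

  +•-commutes : {φ ψ χ : CMat} (k : Carrier) → Commutes φ χ → Commutes ψ χ → Commutes (φ +ᶜ k • ψ) χ
  +•-commutes {φ} {ψ} {χ} k φχ ψχ i j = begin
    ((φ +ᶜ k • ψ) ⋆ χ) i j       ≈⟨ ⋆-distribʳ φ ψ χ k i j ⟩
    (φ ⋆ χ) i j + k * (ψ ⋆ χ) i j ≈⟨ +-cong (φχ i j) (*-congˡ (ψχ i j)) ⟩
    (χ ⋆ φ) i j + k * (χ ⋆ ψ) i j ≈⟨ ⋆-distribˡ φ ψ χ k i j ⟨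
    (χ ⋆ (φ +ᶜ k • ψ)) i j       ∎

module CoordinateGenerators {c ℓ : Level} (R : CommutativeRing c ℓ) (m : ℕ) (b : Fin m) where
  open CommutativeRing R
  open FiniteSums commutativeSemiring
  open CoordinateMatrices R m public
  open import Relation.Binary.Reasoning.Setoid setoid
  open import Algebra.Properties.Group +-group using (∙-cancelʳ)

  nonBase : Fin m → Bool
  nonBase i = not (does (b ≟ i))

  -- The tensor factors of A_g and E*_g in a coordinate a where g has digit h.
  adjᶜ : Bool → CMat
  adjᶜ h i j = 𝟙 (boolEq (not (does (i ≟ j))) h)

  estᶜ : Bool → CMat
  estᶜ h i j = Iᶜ i j * 𝟙 (boolEq (nonBase i) h)

  K : Carrier
  K = ∑ (allFin m) (𝟙 ∘ nonBase)

  Zᵇ : Bool → Bool → Carrier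
  Zᵇ p q = 𝟙 (p ∧ q) + 𝟙 (not p ∧ not q) * K

  -- Z = E₁* J E₁* + (m - 1) E₀*: it is block diagonal, and all its row and column sums are m - 1.
  Z : CMat
  Z i j = Zᵇ (nonBase i) (nonBase j)

  private
    J : CMat
    J i j = 1#

    ∑-base : (k : Carrier) → ∑ (allFin m) (λ i → 𝟙 (not (nonBase i)) * k) ≈ k
    ∑-base k = trans (∑-cong (allFin m) (λ i → *-congʳ (reflexive (≡.cong 𝟙 (not-involutive _)))))
                     (∑-δˡ _≟_ (λ _ → k) (allFin⁺ m) (∈-allFin b))

    Z⋆J : ∀ i j → (Z ⋆ J) i j ≈ K
    Z⋆J i j with nonBase i
    ... | true  = ∑-cong (allFin m) (λ k → trans (*-identityʳ _) (trans (+-congˡ (zeroˡ K)) (+-identityʳ _)))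
    ... | false = trans (∑-cong (allFin m) (λ k → trans (*-identityʳ _) (+-identityˡ _))) (∑-base K)

    J⋆Z : ∀ i j → (J ⋆ Z) i j ≈ K
    J⋆Z i j with nonBase j
    ... | true  = ∑-cong (allFin m) (λ k → trans (*-identityˡ _)
                    (trans (+-cong (reflexive (≡.cong 𝟙 (∧-identityʳ _))) (trans (*-congʳ (reflexive (≡.cong 𝟙 (∧-zeroʳ _)))) (zeroˡ K)))
                           (+-identityʳ _)))
    ... | false = trans (∑-cong (allFin m) (λ k → trans (*-identityˡ _)
                    (trans (+-cong (reflexive (≡.cong 𝟙 (∧-zeroʳ _))) (*-congʳ (reflexive (≡.cong 𝟙 (∧-identityʳ _)))))
                           (+-identityˡ _))))
                  (∑-base K)

    adj+I≈J : ∀ i j → adjᶜ true i j + Iᶜ i j ≈ J i j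
    adj+I≈J i j = trans (+-congʳ (reflexive (≡.cong 𝟙 (boolEq-true _)))) (𝟙-not _)

    ⋆J-split : (φ : CMat) → ∀ i j → (φ ⋆ J) i j ≈ (φ ⋆ adjᶜ true) i j + φ i j
    ⋆J-split φ i j = begin
      (φ ⋆ J) i j                                         ≈⟨ ⋆-congʳ φ (λ i j → sym (adj+I≈J i j)) i j ⟩
      ∑ (allFin m) (λ k → φ i k * (adjᶜ true k j + Iᶜ k j)) ≈⟨ ∑-cong (allFin m) (λ k → distribˡ _ _ _) ⟩
      ∑ (allFin m) (λ k → φ i k * adjᶜ true k j + φ i k * Iᶜ k j) ≈⟨ ∑-distrib-+ (allFin m) _ _ ⟩
      (φ ⋆ adjᶜ true) i j + (φ ⋆ Iᶜ) i j                  ≈⟨ +-congˡ (⋆-identityʳ φ i j) ⟩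
      (φ ⋆ adjᶜ true) i j + φ i j                         ∎

    J⋆-split : (φ : CMat) → ∀ i j → (J ⋆ φ) i j ≈ (adjᶜ true ⋆ φ) i j + φ i j
    J⋆-split φ i j = begin
      (J ⋆ φ) i j                                         ≈⟨ ⋆-congˡ φ (λ i j → sym (adj+I≈J i j)) i j ⟩
      ∑ (allFin m) (λ k → (adjᶜ true i k + Iᶜ i k) * φ k j) ≈⟨ ∑-cong (allFin m) (λ k → distribʳ _ _ _) ⟩
      ∑ (allFin m) (λ k → adjᶜ true i k * φ k j + Iᶜ i k * φ k j) ≈⟨ ∑-distrib-+ (allFin m) _ _ ⟩
      (adjᶜ true ⋆ φ) i j + (Iᶜ ⋆ φ) i j                  ≈⟨ +-congˡ (⋆-identityˡ φ i j) ⟩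
      (adjᶜ true ⋆ φ) i j + φ i j                         ∎

    Zᵇ-offdiagonal : ∀ p q → ¬ p ≡ q → Zᵇ p q ≈ 0#
    Zᵇ-offdiagonal true  true  p≢q = contradiction ≡.refl p≢q
    Zᵇ-offdiagonal true  false _   = trans (+-identityˡ _) (zeroˡ K)
    Zᵇ-offdiagonal false true  _   = trans (+-identityˡ _) (zeroˡ K)
    Zᵇ-offdiagonal false false p≢q = contradiction ≡.refl p≢q

    Zᵇ-diagonal : ∀ p q h → Zᵇ p q * 𝟙 (boolEq q h) ≈ 𝟙 (boolEq p h) * Zᵇ p q
    Zᵇ-diagonal true  true  h = *-comm _ _
    Zᵇ-diagonal false false h = *-comm _ _
    Zᵇ-diagonal true  false h = trans (*-congʳ (Zᵇ-offdiagonal true false λ ()))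
      (trans (zeroˡ _) (sym (trans (*-congˡ (Zᵇ-offdiagonal true false λ ())) (zeroʳ _))))
    Zᵇ-diagonal false true  h = trans (*-congʳ (Zᵇ-offdiagonal false true λ ()))
      (trans (zeroˡ _) (sym (trans (*-congˡ (Zᵇ-offdiagonal false true λ ())) (zeroʳ _))))

  Z-commutes-adjᶜ : ∀ h → Commutes Z (adjᶜ h)
  Z-commutes-adjᶜ false = commutes-Iᶜ Z (λ i j → reflexive (≡.cong 𝟙 (≡.trans (boolEq-false _) (not-involutive _))))
  Z-commutes-adjᶜ true  i j = ∙-cancelʳ (Z i j) _ _ (begin
    (Z ⋆ adjᶜ true) i j + Z i j ≈⟨ ⋆J-split Z i j ⟨
    (Z ⋆ J) i j                 ≈⟨ Z⋆J i j ⟩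
    K                           ≈⟨ J⋆Z i j ⟨
    (J ⋆ Z) i j                 ≈⟨ J⋆-split Z i j ⟩
    (adjᶜ true ⋆ Z) i j + Z i j ∎)

  Z-commutes-estᶜ : ∀ h → Commutes Z (estᶜ h)
  Z-commutes-estᶜ h i j = begin
    (Z ⋆ estᶜ h) i j      ≈⟨ ⋆-diagonalʳ Z d i j ⟩
    Z i j * d j           ≈⟨ Zᵇ-diagonal (nonBase i) (nonBase j) h ⟩
    d i * Z i j           ≈⟨ ⋆-diagonalˡ Z d i j ⟨
    (estᶜ h ⋆ Z) i j      ∎
    where
    d : Fin m → Carrier
    d k = 𝟙 (boolEq (nonBase k) h)

  estᶜ⋆adjᶜ⋆estᶜ : ∀ s t r i j → (estᶜ s ⋆ (adjᶜ t ⋆ (estᶜ r ⋆ Iᶜ))) i j ≈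
                   𝟙 (boolEq (nonBase i) s) * (adjᶜ t i j * 𝟙 (boolEq (nonBase j) r))
  estᶜ⋆adjᶜ⋆estᶜ s t r i j = begin
    (estᶜ s ⋆ (adjᶜ t ⋆ (estᶜ r ⋆ Iᶜ))) i j ≈⟨ ⋆-congʳ (estᶜ s) (⋆-congʳ (adjᶜ t) (⋆-identityʳ (estᶜ r))) i j ⟩
    (estᶜ s ⋆ (adjᶜ t ⋆ estᶜ r)) i j        ≈⟨ ⋆-diagonalˡ (adjᶜ t ⋆ estᶜ r) (λ k → 𝟙 (boolEq (nonBase k) s)) i j ⟩
    𝟙 (boolEq (nonBase i) s) * (adjᶜ t ⋆ estᶜ r) i j ≈⟨ *-congˡ (⋆-diagonalʳ (adjᶜ t) (λ k → 𝟙 (boolEq (nonBase k) r)) i j) ⟩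
    𝟙 (boolEq (nonBase i) s) * (adjᶜ t i j * 𝟙 (boolEq (nonBase j) r)) ∎

  Z−I : CMat
  Z−I = Z +ᶜ (- 1#) • Iᶜ

-- The Terwilliger algebra as tensor products

module TerwilligerAlgebra {c ℓ : Level} (F : Field c ℓ) {n : ℕ} (u : Fin n → ℕ) (base : Pt u) where
  open Field F hiding (zero)
  open Terwilliger F u base
  open FiniteSums commutativeSemiring
  open PointSums commutativeSemiring
  open import Relation.Binary.Reasoning.Setoid setoid
  open import Algebra.Properties.CommutativeSemigroup *-commutativeSemigroup using (x∙yz≈y∙xz)

  private
    Pts = allPts u

  *ₘ-congˡ : {M M′ : Mat} (N : Mat) → M ≈ₘ M′ → (M *ₘ N) ≈ₘ (M′ *ₘ N)
  *ₘ-congˡ N M≈M′ x y = ∑-cong Pts (λ w → *-congʳ (M≈M′ x w))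

  *ₘ-congʳ : (M : Mat) {N N′ : Mat} → N ≈ₘ N′ → (M *ₘ N) ≈ₘ (M *ₘ N′)
  *ₘ-congʳ M N≈N′ x y = ∑-cong Pts (λ w → *-congˡ (N≈N′ w y))

  *ₘ-zeroˡ : (N : Mat) → (0ₘ *ₘ N) ≈ₘ 0ₘ
  *ₘ-zeroˡ N x y = trans (∑-cong Pts (λ w → zeroˡ _)) (∑-zero Pts)

  *ₘ-zeroʳ : (M : Mat) → (M *ₘ 0ₘ) ≈ₘ 0ₘ
  *ₘ-zeroʳ M x y = trans (∑-cong Pts (λ w → zeroʳ _)) (∑-zero Pts)

  *ₘ-linearˡ : (k : Carrier) (M M′ N : Mat) → (((k •ₘ M) +ₘ M′) *ₘ N) ≈ₘ ((k •ₘ (M *ₘ N)) +ₘ (M′ *ₘ N))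
  *ₘ-linearˡ k M M′ N x y = begin
    ∑ Pts (λ w → (k * M x w + M′ x w) * N w y)         ≈⟨ ∑-cong Pts (λ w → trans (distribʳ _ _ _) (+-congʳ (*-assoc _ _ _))) ⟩
    ∑ Pts (λ w → k * (M x w * N w y) + M′ x w * N w y) ≈⟨ ∑-distrib-+ Pts _ _ ⟩
    ∑ Pts (λ w → k * (M x w * N w y)) + (M′ *ₘ N) x y  ≈⟨ +-congʳ (*-distribˡ-∑ Pts _ _) ⟨
    k * (M *ₘ N) x y + (M′ *ₘ N) x y                   ∎

  *ₘ-linearʳ : (k : Carrier) (M M′ N : Mat) → (N *ₘ ((k •ₘ M) +ₘ M′)) ≈ₘ ((k •ₘ (N *ₘ M)) +ₘ (N *ₘ M′))
  *ₘ-linearʳ k M M′ N x y = begin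
    ∑ Pts (λ w → N x w * (k * M w y + M′ w y))         ≈⟨ ∑-cong Pts (λ w → trans (distribˡ _ _ _) (+-congʳ (x∙yz≈y∙xz _ _ _))) ⟩
    ∑ Pts (λ w → k * (N x w * M w y) + N x w * M′ w y) ≈⟨ ∑-distrib-+ Pts _ _ ⟩
    ∑ Pts (λ w → k * (N x w * M w y)) + (N *ₘ M′) x y  ≈⟨ +-congʳ (*-distribˡ-∑ Pts _ _) ⟨
    k * (N *ₘ M) x y + (N *ₘ M′) x y                   ∎

  Commutesₘ : Mat → Mat → Set ℓ
  Commutesₘ M N = (M *ₘ N) ≈ₘ (N *ₘ M)

  Central : Mat → Set (c ⊔ ℓ)
  Central M = ∀ N → InT N → Commutesₘ M N

  commutesₘ-sym : {M N : Mat} → Commutesₘ M N → Commutesₘ N M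
  commutesₘ-sym MN x y = sym (MN x y)

  commutesₘ-0ₘ : (M : Mat) → Commutesₘ 0ₘ M
  commutesₘ-0ₘ M x y = trans (*ₘ-zeroˡ M x y) (sym (*ₘ-zeroʳ M x y))

  commutesₘ-linear : (k : Carrier) {M M′ N : Mat} → Commutesₘ M N → Commutesₘ M′ N → Commutesₘ ((k •ₘ M) +ₘ M′) N
  commutesₘ-linear k {M} {M′} {N} MN M′N x y = begin
    (((k •ₘ M) +ₘ M′) *ₘ N) x y      ≈⟨ *ₘ-linearˡ k M M′ N x y ⟩
    k * (M *ₘ N) x y + (M′ *ₘ N) x y ≈⟨ +-cong (*-congˡ (MN x y)) (M′N x y) ⟩
    k * (N *ₘ M) x y + (N *ₘ M′) x y ≈⟨ *ₘ-linearʳ k M M′ N x y ⟨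
    (N *ₘ ((k •ₘ M) +ₘ M′)) x y      ∎

  commutesₘ-combo : {m : ℕ} (k : Fin m → Carrier) (B : Fin m → Mat) {N : Mat} → (∀ j → Commutesₘ (B j) N) → Commutesₘ (combo k B) N
  commutesₘ-combo {zero}  k B BN = commutesₘ-0ₘ _
  commutesₘ-combo {suc m} k B BN = commutesₘ-linear (k zero) (BN zero) (commutesₘ-combo (k ∘ suc) (B ∘ suc) (BN ∘ suc))

  central-if-commutes-with-words : (M : Mat) → (∀ w → Commutesₘ M (evalWord w)) → Central M
  central-if-commutes-with-words M Mw N (ts , N≈ts) x y = begin
    (M *ₘ N) x y          ≈⟨ *ₘ-congʳ M N≈ts x y ⟩
    (M *ₘ lincomb ts) x y ≈⟨ commutesₘ-sym (lincomb-commutes ts) x y ⟩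
    (lincomb ts *ₘ M) x y ≈⟨ *ₘ-congˡ M N≈ts x y ⟨
    (N *ₘ M) x y          ∎
    where
    lincomb-commutes : ∀ ts → Commutesₘ (lincomb ts) M
    lincomb-commutes []             = commutesₘ-0ₘ M
    lincomb-commutes ((k , w) ∷ ts) = commutesₘ-linear k (commutesₘ-sym (Mw w)) (lincomb-commutes ts)

  module C (a : Fin n) = CoordinateGenerators commutativeRing (u a) (base a)

  Tensor : Set c
  Tensor = (a : Fin n) → C.CMat a

  ⊗ : Tensor → Mat
  ⊗ φ x y = ∏ (λ a → φ a (x a) (y a))

  infixl 7 _⊛_
  _⊛_ : Tensor → Tensor → Tensor
  (φ ⊛ ψ) a = C._⋆_ a (φ a) (ψ a)

  ⊗-cong : (φ : Tensor) {x x′ y y′ : Pt u} → x ≋ x′ → y ≋ y′ → ⊗ φ x y ≈ ⊗ φ x′ y′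
  ⊗-cong φ x≋x′ y≋y′ = ∏-cong (λ a → reflexive (≡.cong₂ (φ a) (x≋x′ a) (y≋y′ a)))

  ⊗-*ₘ : (φ ψ : Tensor) → (⊗ φ *ₘ ⊗ ψ) ≈ₘ ⊗ (φ ⊛ ψ)
  ⊗-*ₘ φ ψ x y = begin
    ∑ Pts (λ w → ⊗ φ x w * ⊗ ψ w y)                           ≈⟨ ∑-cong Pts (λ w → ∏-distrib-* {n} _ _) ⟨
    ∑ Pts (λ w → ∏ (λ a → φ a (x a) (w a) * ψ a (w a) (y a))) ≈⟨ ∑-∏-allPts u (λ a k → φ a (x a) k * ψ a k (y a)) ⟩
    ⊗ (φ ⊛ ψ) x y                                             ∎

  genᶜ : Gen → Tensor
  genᶜ (genA g) a = C.adjᶜ a (bit g a)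
  genᶜ (genE g) a = C.estᶜ a (bit g a)

  wordᶜ : List Gen → Tensor
  wordᶜ []       = C.Iᶜ
  wordᶜ (s ∷ ws) = genᶜ s ⊛ wordᶜ ws

  evalGen-⊗ : (s : Gen) → evalGen s ≈ₘ ⊗ (genᶜ s)
  evalGen-⊗ (genA g) x y = 𝟙-all (λ a → boolEq (not (coordEq x y a)) (bit g a))
  evalGen-⊗ (genE g) x y = begin
    𝟙 (ptEq x y ∧ inR g base x)                             ≈⟨ 𝟙-∧ _ _ ⟩
    𝟙 (ptEq x y) * 𝟙 (inR g base x)                         ≈⟨ *-cong (𝟙-all (coordEq x y)) (𝟙-all (λ a → boolEq (not (coordEq base x a)) (bit g a))) ⟩
    ∏ (λ a → C.Iᶜ a (x a) (y a)) * ∏ (λ a → 𝟙 (boolEq (C.nonBase a (x a)) (bit g a))) ≈⟨ ∏-distrib-* {n} _ _ ⟨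
    ⊗ (genᶜ (genE g)) x y                                   ∎

  evalWord-⊗ : (ws : List Gen) → evalWord ws ≈ₘ ⊗ (wordᶜ ws)
  evalWord-⊗ []       x y = 𝟙-all (coordEq x y)
  evalWord-⊗ (s ∷ ws) x y = trans (∑-cong Pts (λ w → *-cong (evalGen-⊗ s x w) (evalWord-⊗ ws w y))) (⊗-*ₘ (genᶜ s) (wordᶜ ws) x y)

  lincomb-⊗ : (ts : List (Carrier × List Gen)) → lincomb ts ≈ₘ (λ x y → ∑ ts (λ t → proj₁ t * ⊗ (wordᶜ (proj₂ t)) x y))
  lincomb-⊗ []             x y = refl
  lincomb-⊗ ((k , w) ∷ ts) x y = +-cong (*-congˡ (evalWord-⊗ w x y)) (lincomb-⊗ ts x y)

  InT-cong : {M : Mat} → InT M → {x x′ y y′ : Pt u} → x ≋ x′ → y ≋ y′ → M x y ≈ M x′ y′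
  InT-cong {M} (ts , M≈ts) {x} {x′} {y} {y′} x≋x′ y≋y′ = begin
    M x y                                               ≈⟨ trans (M≈ts x y) (lincomb-⊗ ts x y) ⟩
    ∑ ts (λ t → proj₁ t * ⊗ (wordᶜ (proj₂ t)) x y)      ≈⟨ ∑-cong ts (λ t → *-congˡ (⊗-cong (wordᶜ (proj₂ t)) x≋x′ y≋y′)) ⟩
    ∑ ts (λ t → proj₁ t * ⊗ (wordᶜ (proj₂ t)) x′ y′)    ≈⟨ trans (M≈ts x′ y′) (lincomb-⊗ ts x′ y′) ⟨
    M x′ y′                                             ∎

  CommutesWithGenerators : Tensor → Set ℓ
  CommutesWithGenerators ψ = ∀ a s → C.Commutes a (ψ a) (genᶜ s a)

  central-⊗ : (ψ : Tensor) → CommutesWithGenerators ψ → Central (⊗ ψ)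
  central-⊗ ψ ψ-gen = central-if-commutes-with-words (⊗ ψ) λ ws x y → begin
    (⊗ ψ *ₘ evalWord ws) x y        ≈⟨ *ₘ-congʳ (⊗ ψ) (evalWord-⊗ ws) x y ⟩
    (⊗ ψ *ₘ ⊗ (wordᶜ ws)) x y       ≈⟨ ⊗-*ₘ ψ (wordᶜ ws) x y ⟩
    ⊗ (ψ ⊛ wordᶜ ws) x y            ≈⟨ ∏-cong (λ a → commutes-word ws a (x a) (y a)) ⟩
    ⊗ (wordᶜ ws ⊛ ψ) x y            ≈⟨ ⊗-*ₘ (wordᶜ ws) ψ x y ⟨
    (⊗ (wordᶜ ws) *ₘ ⊗ ψ) x y       ≈⟨ *ₘ-congˡ (⊗ ψ) (evalWord-⊗ ws) x y ⟨
    (evalWord ws *ₘ ⊗ ψ) x y        ∎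
    where
    commutes-word : ∀ ws a → C.Commutes a (ψ a) (wordᶜ ws a)
    commutes-word []       a = C.commutes-Iᶜ a (ψ a) (λ _ _ → refl)
    commutes-word (s ∷ ws) a = C.commutes-⋆ a (ψ-gen a s) (commutes-word ws a)

  PtPermutation : Set
  PtPermutation = (a : Fin n) → Permutation′ (u a)

  infixr 9 _·_
  _·_ : PtPermutation → Pt u → Pt u
  (σ · x) a = σ a ⟨$⟩ʳ x a

  FixesBase : PtPermutation → Set
  FixesBase σ = ∀ a → σ a ⟨$⟩ʳ base a ≡ base a

  module _ (σ : PtPermutation) (σ-base : FixesBase σ) where

    private
      does-≟-σ : ∀ a (i j : Fin (u a)) → does (σ a ⟨$⟩ʳ i ≟ σ a ⟨$⟩ʳ j) ≡ does (i ≟ j)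
      does-≟-σ a i j = does-⇔ (mk⇔ (permutation-injective (σ a)) (≡.cong (σ a ⟨$⟩ʳ_))) (σ a ⟨$⟩ʳ i ≟ σ a ⟨$⟩ʳ j) (i ≟ j)

      nonBase-σ : ∀ a (i : Fin (u a)) → C.nonBase a (σ a ⟨$⟩ʳ i) ≡ C.nonBase a i
      nonBase-σ a i = ≡.cong not (≡.trans (≡.cong (λ b → does (b ≟ σ a ⟨$⟩ʳ i)) (≡.sym (σ-base a))) (does-≟-σ a (base a) i))

      genᶜ-σ : ∀ s a (i j : Fin (u a)) → genᶜ s a (σ a ⟨$⟩ʳ i) (σ a ⟨$⟩ʳ j) ≡ genᶜ s a i j
      genᶜ-σ (genA g) a i j = ≡.cong (λ p → 𝟙 (boolEq (not p) (bit g a))) (does-≟-σ a i j)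
      genᶜ-σ (genE g) a i j = ≡.cong₂ (λ p q → 𝟙 p * 𝟙 (boolEq q (bit g a))) (does-≟-σ a i j) (nonBase-σ a i)

      wordᶜ-σ : ∀ ws a (i j : Fin (u a)) → wordᶜ ws a (σ a ⟨$⟩ʳ i) (σ a ⟨$⟩ʳ j) ≈ wordᶜ ws a i j
      wordᶜ-σ []       a i j = reflexive (≡.cong 𝟙 (does-≟-σ a i j))
      wordᶜ-σ (s ∷ ws) a i j = begin
        ∑ (allFin (u a)) (λ k → genᶜ s a (σ a ⟨$⟩ʳ i) k * wordᶜ ws a k (σ a ⟨$⟩ʳ j))
          ≈⟨ ∑-permute (σ a) (λ k → genᶜ s a (σ a ⟨$⟩ʳ i) k * wordᶜ ws a k (σ a ⟨$⟩ʳ j)) ⟨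
        ∑ (allFin (u a)) (λ k → genᶜ s a (σ a ⟨$⟩ʳ i) (σ a ⟨$⟩ʳ k) * wordᶜ ws a (σ a ⟨$⟩ʳ k) (σ a ⟨$⟩ʳ j))
          ≈⟨ ∑-cong (allFin (u a)) (λ k → *-cong (reflexive (genᶜ-σ s a i k)) (wordᶜ-σ ws a k j)) ⟩
        ∑ (allFin (u a)) (λ k → genᶜ s a i k * wordᶜ ws a k j) ∎

    InT-invariant : {M : Mat} → InT M → ∀ x y → M (σ · x) (σ · y) ≈ M x y
    InT-invariant {M} (ts , M≈ts) x y = begin
      M (σ · x) (σ · y)                                       ≈⟨ trans (M≈ts _ _) (lincomb-⊗ ts _ _) ⟩
      ∑ ts (λ t → proj₁ t * ⊗ (wordᶜ (proj₂ t)) (σ · x) (σ · y)) ≈⟨ ∑-cong ts (λ t → *-congˡ (∏-cong (λ a → wordᶜ-σ (proj₂ t) a (x a) (y a)))) ⟩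
      ∑ ts (λ t → proj₁ t * ⊗ (wordᶜ (proj₂ t)) x y)          ≈⟨ trans (M≈ts x y) (lincomb-⊗ ts x y) ⟨
      M x y                                                   ∎

  lincomb-∑ : (ts : List (Carrier × List Gen)) (x y : Pt u) → lincomb ts x y ≡ ∑ ts (λ t → proj₁ t * evalWord (proj₂ t) x y)
  lincomb-∑ []             x y = ≡.refl
  lincomb-∑ ((k , w) ∷ ts) x y = ≡.cong (k * evalWord w x y +_) (lincomb-∑ ts x y)

  InT-resp : {M N : Mat} → M ≈ₘ N → InT M → InT N
  InT-resp M≈N (ts , M≈ts) = ts , λ x y → trans (sym (M≈N x y)) (M≈ts x y)

  private
    E*AE* : Fin (2 ^ n) → Fin (2 ^ n) → Fin (2 ^ n) → List Gen
    E*AE* g h k = genE g ∷ genA h ∷ genE k ∷ []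

    E*AE*-value : ∀ g h k x y → evalWord (E*AE* g h k) x y ≈ 𝟙 (inR g base x) * (𝟙 (inR h x y) * 𝟙 (inR k base y))
    E*AE*-value g h k x y = begin
      evalWord (E*AE* g h k) x y ≈⟨ evalWord-⊗ (E*AE* g h k) x y ⟩
      ⊗ (wordᶜ (E*AE* g h k)) x y
        ≈⟨ ∏-cong (λ a → C.estᶜ⋆adjᶜ⋆estᶜ a (bit g a) (bit h a) (bit k a) (x a) (y a)) ⟩
      ∏ (λ a → 𝟙 (boolEq (C.nonBase a (x a)) (bit g a)) * (𝟙 (boolEq (not (coordEq x y a)) (bit h a)) * 𝟙 (boolEq (C.nonBase a (y a)) (bit k a))))
        ≈⟨ trans (∏-distrib-* {n} _ _) (*-congˡ (∏-distrib-* {n} _ _)) ⟩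
      ∏ (λ a → 𝟙 (boolEq (C.nonBase a (x a)) (bit g a))) * (∏ (λ a → 𝟙 (boolEq (not (coordEq x y a)) (bit h a))) * ∏ (λ a → 𝟙 (boolEq (C.nonBase a (y a)) (bit k a))))
        ≈⟨ *-cong (𝟙-all {n} _) (*-cong (𝟙-all {n} _) (𝟙-all {n} _)) ⟨
      𝟙 (inR g base x) * (𝟙 (inR h x y) * 𝟙 (inR k base y)) ∎

  -- It is the combination of the E*_g A_h E*_k with coefficients f g h k.
  relationMatrix-∈T : (f : Fin (2 ^ n) → Fin (2 ^ n) → Fin (2 ^ n) → Carrier) → InT (λ x y → f (relation base x) (relation x y) (relation base y))
  relationMatrix-∈T f = ts , λ x y → sym (lincomb-ts x y)
    where
    G = allFin (2 ^ n)
    ts : List (Carrier × List Gen)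
    ts = concatMap (λ g → concatMap (λ h → map (λ k → f g h k , E*AE* g h k) G) G) G
    lincomb-ts : ∀ x y → lincomb ts x y ≈ f (relation base x) (relation x y) (relation base y)
    lincomb-ts x y = begin
      lincomb ts x y
        ≡⟨ lincomb-∑ ts x y ⟩
      ∑ ts W
        ≈⟨ trans (∑-concatMap _ G W) (∑-cong G (λ g → trans (∑-concatMap _ G W) (∑-cong G (λ h → reflexive (∑-map _ G W))))) ⟩
      ∑ G (λ g → ∑ G (λ h → ∑ G (λ k → f g h k * evalWord (E*AE* g h k) x y)))
        ≈⟨ ∑-cong G (λ g → ∑-cong G (λ h → ∑-cong G (λ k → trans (*-congˡ (E*AE*-value g h k x y)) (rearrange g h k)))) ⟩
      ∑ G (λ g → ∑ G (λ h → ∑ G (λ k → δ g (relation base x) * (δ h (relation x y) * (δ k (relation base y) * f g h k)))))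
        ≈⟨ ∑-cong G (λ g → trans (*-distribˡ-∑ G _ _) (∑-cong G (λ h → trans (*-congˡ (*-distribˡ-∑ G _ _)) (*-distribˡ-∑ G _ _)))) ⟨
      ∑ G (λ g → δ g (relation base x) * ∑ G (λ h → δ h (relation x y) * ∑ G (λ k → δ k (relation base y) * f g h k)))
        ≈⟨ ∑-δʳ _≟_ _ (allFin⁺ (2 ^ n)) (∈-allFin (relation base x)) ⟩
      ∑ G (λ h → δ h (relation x y) * ∑ G (λ k → δ k (relation base y) * f (relation base x) h k))
        ≈⟨ ∑-δʳ _≟_ _ (allFin⁺ (2 ^ n)) (∈-allFin (relation x y)) ⟩
      ∑ G (λ k → δ k (relation base y) * f (relation base x) (relation x y) k)
        ≈⟨ ∑-δʳ _≟_ _ (allFin⁺ (2 ^ n)) (∈-allFin (relation base y)) ⟩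
      f (relation base x) (relation x y) (relation base y) ∎
      where
      W : Carrier × List Gen → Carrier
      W t = proj₁ t * evalWord (proj₂ t) x y
      δ : Fin (2 ^ n) → Fin (2 ^ n) → Carrier
      δ g g′ = 𝟙 (does (g ≟ g′))
      rearrange : ∀ g h k → f g h k * (𝟙 (inR g base x) * (𝟙 (inR h x y) * 𝟙 (inR k base y))) ≈
                            δ g (relation base x) * (δ h (relation x y) * (δ k (relation base y) * f g h k))
      rearrange g h k = begin
        f g h k * (𝟙 (inR g base x) * (𝟙 (inR h x y) * 𝟙 (inR k base y)))
          ≈⟨ trans (*-comm _ _) (trans (*-assoc _ _ _) (*-congˡ (*-assoc _ _ _))) ⟩
        𝟙 (inR g base x) * (𝟙 (inR h x y) * (𝟙 (inR k base y) * f g h k))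
          ≡⟨ ≡.cong₂ (λ p q → 𝟙 p * q) (inR-relation g base x) (≡.cong₂ (λ p q → 𝟙 p * (𝟙 q * f g h k)) (inR-relation h x y) (inR-relation k base y)) ⟩
        δ g (relation base x) * (δ h (relation x y) * (δ k (relation base y) * f g h k)) ∎

  coordinatewiseMatrix-∈T : (f : (a : Fin n) → Bool → Bool → Bool → Carrier) →
    InT (λ x y → ∏ (λ a → f a (C.nonBase a (x a)) (not (coordEq x y a)) (C.nonBase a (y a))))
  coordinatewiseMatrix-∈T f = InT-resp (λ x y → ∏-cong (λ a → reflexive (bits x y a)))
                                       (relationMatrix-∈T (λ g h k → ∏ (λ a → f a (bit g a) (bit h a) (bit k a))))
    where
    bits : ∀ x y a → f a (bit (relation base x) a) (bit (relation x y) a) (bit (relation base y) a) ≡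
                     f a (C.nonBase a (x a)) (not (coordEq x y a)) (C.nonBase a (y a))
    bits x y a = ≡.cong₂ (λ p (qr : Bool × Bool) → f a p (proj₁ qr) (proj₂ qr)) (bit-encode _ a) (≡.cong₂ _,_ (bit-encode _ a) (bit-encode _ a))

  Respects≋ₘ : Mat → Set ℓ
  Respects≋ₘ P = ∀ {x x′ y y′} → x ≋ x′ → y ≋ y′ → P x y ≈ P x′ y′

  *ₘ-identityʳ : (M : Mat) → Respects≋ₘ M → (M *ₘ 1ₘ) ≈ₘ M
  *ₘ-identityʳ M M-cong x y = begin
    ∑ Pts (λ w → M x w * 𝟙 (ptEq w y)) ≈⟨ ∑-cong Pts (λ w → trans (*-comm _ _) (*-congʳ (reflexive (≡.cong 𝟙 (ptEq-sym w y))))) ⟩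
    ∑ Pts (λ w → 𝟙 (ptEq y w) * M x w) ≈⟨ ∑-δ-allPts u y (M x) (M-cong (λ _ → ≡.refl)) ⟩
    M x y                               ∎

  generator-∈T : (s : Gen) → InT (evalGen s)
  generator-∈T s = (1# , s ∷ []) ∷ [] , λ x y → sym (begin
    1# * (evalGen s *ₘ 1ₘ) x y + 0# ≈⟨ trans (+-identityʳ _) (*-identityˡ _) ⟩
    (evalGen s *ₘ 1ₘ) x y           ≈⟨ *ₘ-identityʳ (evalGen s) evalGen-cong x y ⟩
    evalGen s x y                   ∎)
    where
    evalGen-cong : Respects≋ₘ (evalGen s)
    evalGen-cong x≋x′ y≋y′ = trans (evalGen-⊗ s _ _) (trans (⊗-cong (genᶜ s) x≋x′ y≋y′) (sym (evalGen-⊗ s _ _)))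

-- Central matrices

module CentralMatrices {c ℓ : Level} (F : Field c ℓ) {n : ℕ} (u : Fin n → ℕ) (base : Pt u) where
  open Field F hiding (zero)
  open Terwilliger F u base
  open FiniteSums commutativeSemiring
  open PointSums commutativeSemiring
  open TerwilligerAlgebra F u base
  open import Relation.Binary.Reasoning.Setoid setoid
  open import Algebra.Properties.CommutativeSemigroup *-commutativeSemigroup using (x∙yz≈y∙xz)

  private
    Pts = allPts u

    Estar-*ₘ : (g : Fin (2 ^ n)) (P : Mat) → Respects≋ₘ P → ∀ x y → (Estar g *ₘ P) x y ≈ 𝟙 (inR g base x) * P x y
    Estar-*ₘ g P P-cong x y = begin
      ∑ Pts (λ w → 𝟙 (ptEq x w ∧ inR g base x) * P w y)   ≈⟨ ∑-cong Pts (λ w → trans (*-congʳ (𝟙-∧ _ _)) (*-assoc _ _ _)) ⟩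
      ∑ Pts (λ w → 𝟙 (ptEq x w) * (𝟙 (inR g base x) * P w y)) ≈⟨ ∑-δ-allPts u x _ (λ w≋w′ → *-congˡ (P-cong w≋w′ (λ _ → ≡.refl))) ⟩
      𝟙 (inR g base x) * P x y                              ∎

    *ₘ-Estar : (g : Fin (2 ^ n)) (P : Mat) → Respects≋ₘ P → ∀ x y → (P *ₘ Estar g) x y ≈ P x y * 𝟙 (inR g base y)
    *ₘ-Estar g P P-cong x y = begin
      ∑ Pts (λ w → P x w * 𝟙 (ptEq w y ∧ inR g base w))
        ≈⟨ ∑-cong Pts (λ w → trans (*-congˡ (trans (reflexive (≡.cong (λ p → 𝟙 (p ∧ _)) (ptEq-sym w y))) (𝟙-∧ _ _))) (x∙yz≈y∙xz _ _ _)) ⟩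
      ∑ Pts (λ w → 𝟙 (ptEq y w) * (P x w * 𝟙 (inR g base w)))
        ≈⟨ ∑-δ-allPts u y _ (λ w≋w′ → *-cong (P-cong (λ _ → ≡.refl) w≋w′) (reflexive (≡.cong 𝟙 (inR-cong g {base} (λ _ → ≡.refl) w≋w′)))) ⟩
      P x y * 𝟙 (inR g base y) ∎
  
  central-vanishes : {P : Mat} → Central P → Respects≋ₘ P → ∀ {x y} → relation base x ≢ relation base y → P x y ≈ 0#
  central-vanishes {P} P-central P-cong {x} {y} relations≢ = begin
    P x y                       ≈⟨ *-identityˡ _ ⟨
    1# * P x y                  ≡⟨ ≡.cong (λ p → 𝟙 p * P x y) (≡.trans (inR-relation g base x) (dec-true (g ≟ relation base x) ≡.refl)) ⟨
    𝟙 (inR g base x) * P x y    ≈⟨ Estar-*ₘ g P P-cong x y ⟨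
    (Estar g *ₘ P) x y          ≈⟨ P-central (Estar g) (generator-∈T (genE g)) x y ⟨
    (P *ₘ Estar g) x y          ≈⟨ *ₘ-Estar g P P-cong x y ⟩
    P x y * 𝟙 (inR g base y)    ≡⟨ ≡.cong (λ p → P x y * 𝟙 p) (≡.trans (inR-relation g base y) (dec-false (g ≟ relation base y) relations≢)) ⟩
    P x y * 0#                  ≈⟨ zeroʳ _ ⟩
    0#                          ∎
    where
    g = relation base x

  module _ (a₀ : Fin n) where

    private
      -- E₁* J E₀* in coordinate a₀, the identity in the other coordinates
      liftᶜ : (a : Fin n) → Bool → Bool → Bool → Carrier
      liftᶜ a s t r = if does (a ≟ a₀) then 𝟙 (s ∧ not r) else 𝟙 (not t)

      Lift : Mat
      Lift x y = ∏ (λ a → liftᶜ a (C.nonBase a (x a)) (not (coordEq x y a)) (C.nonBase a (y a)))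

      nonBase-base : ∀ a → C.nonBase a (base a) ≡ false
      nonBase-base a = ≡.cong not (dec-true (base a ≟ base a) ≡.refl)

      Lift-left : ∀ {x i₀} → x a₀ ≡ base a₀ → base a₀ ≢ i₀ → ∀ w → Lift (x [ a₀ ≔ i₀ ]) w ≈ 𝟙 (ptEq x w)
      Lift-left {x} {i₀} x-base i₀-nonBase w = trans (∏-cong coordinate) (sym (𝟙-all (coordEq x w)))
        where
        coordinate : ∀ a → liftᶜ a (C.nonBase a ((x [ a₀ ≔ i₀ ]) a)) (not (coordEq (x [ a₀ ≔ i₀ ]) w a)) (C.nonBase a (w a)) ≈ 𝟙 (coordEq x w a)
        coordinate a with a ≟ a₀
        ... | yes ≡.refl = reflexive (≡.cong 𝟙 (≡.cong₂ _∧_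
                (≡.trans (≡.cong (C.nonBase a) (update-same x a i₀)) (≡.cong not (dec-false (base a ≟ i₀) i₀-nonBase)))
                (≡.trans (not-involutive _) (≡.cong (λ b → does (b ≟ w a)) (≡.sym x-base)))))
        ... | no  a≢a₀   = reflexive (≡.cong 𝟙 (≡.trans (not-involutive _) (≡.cong (λ b → does (b ≟ w a)) (update-other x a₀ i₀ a≢a₀))))

      Lift-right : ∀ {y} → y a₀ ≡ base a₀ → ∀ w → Lift w y ≈ ∑ (allFin (u a₀)) (λ i → 𝟙 (C.nonBase a₀ i) * 𝟙 (ptEq (y [ a₀ ≔ i ]) w))
      Lift-right {y} y-base w = begin
        Lift w y
          ≈⟨ ∏-pull _ a₀ ⟩
        liftᶜ a₀ (C.nonBase a₀ (w a₀)) (not (coordEq w y a₀)) (C.nonBase a₀ (y a₀)) *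
        ∏ (λ a → if does (a ≟ a₀) then 1# else liftᶜ a (C.nonBase a (w a)) (not (coordEq w y a)) (C.nonBase a (y a)))
          ≈⟨ *-cong (reflexive (≡.trans (≡.cong (λ b → if b then _ else _) (dec-true (a₀ ≟ a₀) ≡.refl))
                                         (≡.cong (λ b → 𝟙 (C.nonBase a₀ (w a₀) ∧ not b)) (≡.trans (≡.cong (C.nonBase a₀) y-base) (nonBase-base a₀)))))
                    (∏-cong others) ⟩
        𝟙 (C.nonBase a₀ (w a₀) ∧ true) * rest y
          ≈⟨ *-congʳ (reflexive (≡.cong 𝟙 (∧-identityʳ _))) ⟩
        𝟙 (C.nonBase a₀ (w a₀)) * rest y
          ≈⟨ ∑-δʳ _≟_ (λ i → 𝟙 (C.nonBase a₀ i) * rest y) (allFin⁺ (u a₀)) (∈-allFin (w a₀)) ⟨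
        ∑ (allFin (u a₀)) (λ i → 𝟙 (does (i ≟ w a₀)) * (𝟙 (C.nonBase a₀ i) * rest y))
          ≈⟨ ∑-cong (allFin (u a₀)) (λ i → trans (x∙yz≈y∙xz _ _ _) (*-congˡ (sym (ptEq-update i)))) ⟩
        ∑ (allFin (u a₀)) (λ i → 𝟙 (C.nonBase a₀ i) * 𝟙 (ptEq (y [ a₀ ≔ i ]) w)) ∎
        where
        rest : Pt u → Carrier
        rest z = ∏ (λ a → if does (a ≟ a₀) then 1# else 𝟙 (coordEq z w a))
        others : ∀ a → (if does (a ≟ a₀) then 1# else liftᶜ a (C.nonBase a (w a)) (not (coordEq w y a)) (C.nonBase a (y a))) ≈
                       (if does (a ≟ a₀) then 1# else 𝟙 (coordEq y w a))
        others a with a ≟ a₀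
        ... | yes _ = refl
        ... | no  _ = reflexive (≡.cong 𝟙 (≡.trans (not-involutive _) (coordEq-sym w y a)))
        ptEq-update : ∀ i → 𝟙 (ptEq (y [ a₀ ≔ i ]) w) ≈ 𝟙 (does (i ≟ w a₀)) * rest y
        ptEq-update i = begin
          𝟙 (ptEq (y [ a₀ ≔ i ]) w) ≈⟨ 𝟙-all (coordEq (y [ a₀ ≔ i ]) w) ⟩
          ∏ (λ a → 𝟙 (coordEq (y [ a₀ ≔ i ]) w a)) ≈⟨ ∏-pull _ a₀ ⟩
          𝟙 (coordEq (y [ a₀ ≔ i ]) w a₀) * rest (y [ a₀ ≔ i ])
            ≈⟨ *-cong (reflexive (≡.cong (λ j → 𝟙 (does (j ≟ w a₀))) (update-same y a₀ i))) (∏-cong updated) ⟩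
          𝟙 (does (i ≟ w a₀)) * rest y ∎
          where
          updated : ∀ a → (if does (a ≟ a₀) then 1# else 𝟙 (coordEq (y [ a₀ ≔ i ]) w a)) ≈ (if does (a ≟ a₀) then 1# else 𝟙 (coordEq y w a))
          updated a with a ≟ a₀
          ... | yes _    = refl
          ... | no  a≢a₀ = reflexive (≡.cong (λ j → 𝟙 (does (j ≟ w a))) (update-other y a₀ i a≢a₀))

    central-reduce : {P : Mat} → Central P → Respects≋ₘ P → ∀ {x y i₀} → x a₀ ≡ base a₀ → y a₀ ≡ base a₀ → base a₀ ≢ i₀ →
                     P x y ≈ ∑ (allFin (u a₀)) (λ i → 𝟙 (C.nonBase a₀ i) * P (x [ a₀ ≔ i₀ ]) (y [ a₀ ≔ i ]))
    central-reduce {P} P-central P-cong {x} {y} {i₀} x-base y-base i₀-nonBase = begin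
      P x y
        ≈⟨ ∑-δ-allPts u x (λ w → P w y) (λ w≋w′ → P-cong w≋w′ (λ _ → ≡.refl)) ⟨
      ∑ Pts (λ w → 𝟙 (ptEq x w) * P w y)
        ≈⟨ ∑-cong Pts (λ w → *-congʳ (Lift-left x-base i₀-nonBase w)) ⟨
      (Lift *ₘ P) x′ y
        ≈⟨ P-central Lift (coordinatewiseMatrix-∈T liftᶜ) x′ y ⟨
      (P *ₘ Lift) x′ y
        ≈⟨ ∑-cong Pts (λ w → trans (*-congˡ (Lift-right y-base w)) (*-distribˡ-∑ I _ _)) ⟩
      ∑ Pts (λ w → ∑ I (λ i → P x′ w * (𝟙 (C.nonBase a₀ i) * 𝟙 (ptEq (y [ a₀ ≔ i ]) w))))
        ≈⟨ ∑-comm Pts I _ ⟩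
      ∑ I (λ i → ∑ Pts (λ w → P x′ w * (𝟙 (C.nonBase a₀ i) * 𝟙 (ptEq (y [ a₀ ≔ i ]) w))))
        ≈⟨ ∑-cong I (λ i → trans (∑-cong Pts (λ w → trans (*-comm _ _) (*-assoc _ _ _))) (sym (*-distribˡ-∑ Pts _ _))) ⟩
      ∑ I (λ i → 𝟙 (C.nonBase a₀ i) * ∑ Pts (λ w → 𝟙 (ptEq (y [ a₀ ≔ i ]) w) * P x′ w))
        ≈⟨ ∑-cong I (λ i → *-congˡ (∑-δ-allPts u (y [ a₀ ≔ i ]) (P x′) (P-cong (λ _ → ≡.refl)))) ⟩
      ∑ I (λ i → 𝟙 (C.nonBase a₀ i) * P x′ (y [ a₀ ≔ i ])) ∎
      where
      x′ = x [ a₀ ≔ i₀ ]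
      I = allFin (u a₀)

  NonBase : Pt u → Set
  NonBase x = ∀ a → base a ≢ x a

  nonBase-true : ∀ {a i} → base a ≢ i → C.nonBase a i ≡ true
  nonBase-true {a} {i} b≢i = ≡.cong not (dec-false (base a ≟ i) b≢i)

  nonBase-false : ∀ {a i} → C.nonBase a i ≡ false → base a ≡ i
  nonBase-false {a} {i} nb≡false with base a ≟ i
  ... | yes b≡i = b≡i

  private
    SameBaseCoordinates : Pt u → Pt u → Set
    SameBaseCoordinates x y = ∀ a → C.nonBase a (x a) ≡ C.nonBase a (y a)

  module _ {P P′ : Mat} (P-central : Central P) (P′-central : Central P′) (P-cong : Respects≋ₘ P) (P′-cong : Respects≋ₘ P′)
           {p : Pt u} (p-nonBase : NonBase p) (agree : ∀ {x y} → NonBase x → NonBase y → P x y ≈ P′ x y) where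

    private
      agree-on : (as : List (Fin n)) → ∀ x y → SameBaseCoordinates x y → (∀ {a} → base a ≡ x a → a ∈ˡ as) → P x y ≈ P′ x y
      agree-on [] x y same base∈ =
        agree (λ a b≡x → ¬Any[] (base∈ b≡x))
              (λ a b≡y → ¬Any[] (base∈ (nonBase-false (≡.trans (same a) (≡.cong not (dec-true (base a ≟ y a) b≡y))))))
        where
        ¬Any[] : ∀ {a : Fin n} → ¬ a ∈ˡ []
        ¬Any[] ()
      agree-on (a₀ ∷ as) x y same base∈ with base a₀ ≟ x a₀
      ... | no b≢x = agree-on as x y same base∈′
        where
        base∈′ : ∀ {a} → base a ≡ x a → a ∈ˡ as
        base∈′ {a} b≡x with base∈ b≡x
        ... | here ≡.refl = contradiction b≡x b≢x
        ... | there a∈as = a∈as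
      ... | yes b≡x = begin
        P x y ≈⟨ central-reduce a₀ P-central P-cong (≡.sym b≡x) y-base (p-nonBase a₀) ⟩
        ∑ (allFin (u a₀)) (λ i → 𝟙 (C.nonBase a₀ i) * P x′ (y [ a₀ ≔ i ])) ≈⟨ ∑-cong (allFin (u a₀)) reduced ⟩
        ∑ (allFin (u a₀)) (λ i → 𝟙 (C.nonBase a₀ i) * P′ x′ (y [ a₀ ≔ i ])) ≈⟨ central-reduce a₀ P′-central P′-cong (≡.sym b≡x) y-base (p-nonBase a₀) ⟨
        P′ x y ∎
        where
        x′ = x [ a₀ ≔ p a₀ ]
        y-base : y a₀ ≡ base a₀
        y-base = ≡.sym (nonBase-false (≡.trans (≡.sym (same a₀)) (≡.cong not (dec-true (base a₀ ≟ x a₀) b≡x))))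
        reduced : ∀ i → 𝟙 (C.nonBase a₀ i) * P x′ (y [ a₀ ≔ i ]) ≈ 𝟙 (C.nonBase a₀ i) * P′ x′ (y [ a₀ ≔ i ])
        reduced i with C.nonBase a₀ i in nb-i
        ... | false = trans (zeroˡ _) (sym (zeroˡ _))
        ... | true  = *-congˡ (agree-on as x′ (y [ a₀ ≔ i ]) same′ base∈′)
          where
          same′ : SameBaseCoordinates x′ (y [ a₀ ≔ i ])
          same′ a with a ≟ a₀
          ... | yes ≡.refl = ≡.trans (≡.cong (C.nonBase a) (update-same x a (p a)))
                               (≡.trans (nonBase-true (p-nonBase a)) (≡.trans (≡.sym nb-i) (≡.cong (C.nonBase a) (≡.sym (update-same y a i)))))
          ... | no  a≢a₀   = ≡.trans (≡.cong (C.nonBase a) (update-other x a₀ (p a₀) a≢a₀))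
                               (≡.trans (same a) (≡.cong (C.nonBase a) (≡.sym (update-other y a₀ i a≢a₀))))
          base∈′ : ∀ {a} → base a ≡ x′ a → a ∈ˡ as
          base∈′ {a} b≡x′ with a ≟ a₀
          ... | yes ≡.refl = contradiction (≡.trans b≡x′ (update-same x a (p a))) (p-nonBase a)
          ... | no  a≢a₀ with base∈ (≡.trans b≡x′ (update-other x a₀ (p a₀) a≢a₀))
          ...   | here a≡a₀  = contradiction a≡a₀ a≢a₀
          ...   | there a∈as = a∈as

    central-agree : P ≈ₘ P′
    central-agree x y with relation base x ≟ relation base y
    ... | no relations≢  = trans (central-vanishes P-central P-cong relations≢) (sym (central-vanishes P′-central P′-cong relations≢))
    ... | yes relations≡ = agree-on (allFin n) x y same (λ {a} _ → ∈-allFin a)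
      where
      same : SameBaseCoordinates x y
      same a = ≡.trans (≡.sym (bit-encode _ a)) (≡.trans (≡.cong (λ g → bit g a) relations≡) (bit-encode _ a))

-- A basis of the centre

module CentreBasis {c ℓ : Level} (F : Field c ℓ) {n : ℕ} (u : Fin n → ℕ) (base : Pt u) (u≥2 : ∀ a → 2 ≤ u a) where
  open Field F hiding (zero)
  open Terwilliger F u base
  open FiniteSums commutativeSemiring
  open TerwilligerAlgebra F u base
  open CentralMatrices F u base
  open import Relation.Binary.Reasoning.Setoid setoid

  p₁ p₂ : Pt u
  p₁ a = other₁ (u≥2 a) (base a)
  p₂ a = other₂ (u≥2 a) (base a)

  p₁-nonBase : NonBase p₁
  p₁-nonBase a = other₁-≢ (u≥2 a) (base a)

  differ : Pt u → Pt u → Subset n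
  differ x y = tabulate (λ a → not (coordEq x y a))

  representative : Subset n → Pt u
  representative Q a = if lookup Q a then p₂ a else p₁ a

  InT-normalise : {M : Mat} → InT M → ∀ {x y} → NonBase x → NonBase y → M x y ≈ M p₁ (representative (differ x y))
  InT-normalise {M} M-∈T {x} {y} x-nonBase y-nonBase = begin
    M x y             ≈⟨ InT-invariant σ σ-base M-∈T x y ⟨
    M (σ · x) (σ · y) ≈⟨ InT-cong M-∈T σx≋p₁ σy≋repr ⟩
    M p₁ (representative (differ x y)) ∎
    where
    normalising : ∀ a → _
    normalising a = normalising-permutation (u≥2 a) (x-nonBase a) (y-nonBase a)
    σ : PtPermutation
    σ a = proj₁ (normalising a)
    σ-base : FixesBase σ
    σ-base a = proj₁ (proj₂ (normalising a))
    σx≋p₁ : σ · x ≋ p₁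
    σx≋p₁ a = proj₁ (proj₂ (proj₂ (normalising a)))
    σy≋repr : σ · y ≋ representative (differ x y)
    σy≋repr a = ≡.trans (proj₂ (proj₂ (proj₂ (normalising a))))
                        (≡.sym (≡.trans (≡.cong (if_then p₂ a else p₁ a) (lookup∘tabulate _ a)) (if-not (does (x a ≟ y a)))))
      where
      if-not : ∀ b → (if not b then p₂ a else p₁ a) ≡ (if b then p₁ a else p₂ a)
      if-not true  = ≡.refl
      if-not false = ≡.refl

  yᶜ : Subset n → Tensor
  yᶜ Q a = if lookup Q a then C.Z−I a else C.Iᶜ a

  Y : Subset n → Mat
  Y Q = ⊗ (yᶜ Q)

  Y-central : (Q : Subset n) → Central (Y Q)
  Y-central Q = central-⊗ (yᶜ Q) commutes
    where
    Z-commutes : ∀ a s → C.Commutes a (C.Z a) (genᶜ s a)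
    Z-commutes a (genA g) = C.Z-commutes-adjᶜ a (bit g a)
    Z-commutes a (genE g) = C.Z-commutes-estᶜ a (bit g a)
    commutes : CommutesWithGenerators (yᶜ Q)
    commutes a s with lookup Q a
    ... | true  = C.+•-commutes a (- 1#) (Z-commutes a s) (C.Iᶜ-commutes a (genᶜ s a))
    ... | false = C.Iᶜ-commutes a (genᶜ s a)

  Y-∈T : (Q : Subset n) → InT (Y Q)
  Y-∈T Q = InT-resp (λ x y → ∏-cong (λ a → coordinate a (x a) (y a))) (coordinatewiseMatrix-∈T f)
    where
    f : (a : Fin n) → Bool → Bool → Bool → Carrier
    f a s t r = if lookup Q a then C.Zᵇ a s r + (- 1#) * 𝟙 (not t) else 𝟙 (not t)
    coordinate : ∀ a i j → f a (C.nonBase a i) (not (does (i ≟ j))) (C.nonBase a j) ≈ yᶜ Q a i j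
    coordinate a i j with lookup Q a
    ... | true  = +-congˡ (*-congˡ (reflexive (≡.cong 𝟙 (not-involutive _))))
    ... | false = reflexive (≡.cong 𝟙 (not-involutive _))

  Y-nonBase : (Q : Subset n) → ∀ {x y} → NonBase x → NonBase y → Y Q x y ≈ 𝟙 (does (≡-dec Bool._≟_ Q (differ x y)))
  Y-nonBase Q {x} {y} x-nonBase y-nonBase = trans (∏-cong coordinate) (∏-boolEq Q (differ x y))
    where
    coordinate : ∀ a → yᶜ Q a (x a) (y a) ≈ 𝟙 (boolEq (lookup Q a) (lookup (differ x y) a))
    coordinate a rewrite lookup∘tabulate (λ a → not (coordEq x y a)) a with lookup Q a
    ... | false = reflexive (≡.cong 𝟙 (≡.sym (not-involutive _)))
    ... | true  = begin
      C.Zᵇ a (C.nonBase a (x a)) (C.nonBase a (y a)) + (- 1#) * 𝟙 (does (x a ≟ y a))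
        ≈⟨ +-congʳ (reflexive (≡.cong₂ (C.Zᵇ a) (nonBase-true (x-nonBase a)) (nonBase-true (y-nonBase a)))) ⟩
      (1# + 0# * C.K a) + (- 1#) * 𝟙 (does (x a ≟ y a))
        ≈⟨ +-congʳ (trans (+-congˡ (zeroˡ _)) (+-identityʳ _)) ⟩
      1# + (- 1#) * 𝟙 (does (x a ≟ y a))
        ≈⟨ one-minus (does (x a ≟ y a)) ⟩
      𝟙 (not (does (x a ≟ y a))) ∎
      where
      one-minus : ∀ p → 1# + (- 1#) * 𝟙 p ≈ 𝟙 (not p)
      one-minus true  = trans (+-congˡ (*-identityʳ _)) (-‿inverseʳ 1#)
      one-minus false = trans (+-congˡ (zeroʳ _)) (+-identityʳ _)

  private
    Qs : List (Subset n)
    Qs = subsetsOf (Large u)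

    Qs-unique : Unique Qs
    Qs-unique = filter⁺ (_⊆? Large u) (allSubsets-unique n)

  basis : Fin (length Qs) → Mat
  basis j = Y (List.lookup Qs j)

  combo-∑ : {m : ℕ} (k : Fin m → Carrier) (B : Fin m → Mat) → combo k B ≈ₘ (λ x y → ∑ (allFin m) (λ j → k j * B j x y))
  combo-∑ {zero}  k B x y = refl
  combo-∑ {suc m} k B x y = trans (+-congˡ (combo-∑ (k ∘ suc) (B ∘ suc) x y)) (reflexive (≡.sym (∑-allFin-suc m _)))

  combo-nonBase : (k : Fin (length Qs) → Carrier) (i : Fin (length Qs)) → ∀ {x y} → NonBase x → NonBase y →
                  List.lookup Qs i ≡ differ x y → combo k basis x y ≈ k i
  combo-nonBase k i {x} {y} x-nonBase y-nonBase Qᵢ≡differ = begin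
    combo k basis x y                                            ≈⟨ combo-∑ k basis x y ⟩
    ∑ (allFin (length Qs)) (λ j → k j * Y (List.lookup Qs j) x y) ≈⟨ ∑-cong (allFin (length Qs)) (λ j → *-congˡ (Y-nonBase (List.lookup Qs j) x-nonBase y-nonBase)) ⟩
    ∑ (allFin (length Qs)) (λ j → k j * 𝟙 (does (≡-dec Bool._≟_ (List.lookup Qs j) (differ x y))))
      ≡⟨ ≡.cong (λ D → ∑ (allFin (length Qs)) (λ j → k j * 𝟙 (does (≡-dec Bool._≟_ (List.lookup Qs j) D)))) (≡.sym Qᵢ≡differ) ⟩
    ∑ (allFin (length Qs)) (λ j → k j * 𝟙 (does (≡-dec Bool._≟_ (List.lookup Qs j) (List.lookup Qs i))))
      ≈⟨ ∑-lookup-δ commutativeSemiring (≡-dec Bool._≟_) Qs-unique k i ⟩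
    k i ∎

  NonBase-representative : (Q : Subset n) → NonBase (representative Q)
  NonBase-representative Q a with lookup Q a
  ... | true  = other₂-≢ (u≥2 a) (base a)
  ... | false = other₁-≢ (u≥2 a) (base a)

  differ-⊆-Large : ∀ {x y} → NonBase x → NonBase y → differ x y ⊆ Large u
  differ-⊆-Large {x} {y} x-nonBase y-nonBase {a} a∈ = Equivalence.from (∈-Large {u = u}) (three-distinct (x-nonBase a) x≢y (y-nonBase a))
    where
    x≢y : x a ≢ y a
    x≢y x≡y = ≡.subst T (≡.cong not (dec-true (x a ≟ y a) x≡y)) (Equivalence.to ∈-tabulate a∈)

  differ-representative : {Q : Subset n} → Q ⊆ Large u → differ p₁ (representative Q) ≡ Q
  differ-representative {Q} Q⊆Large = lookup-extensionality coordinate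
    where
    coordinate : ∀ a → lookup (differ p₁ (representative Q)) a ≡ lookup Q a
    coordinate a rewrite lookup∘tabulate (λ a → not (coordEq p₁ (representative Q) a)) a with lookup Q a in Qa
    ... | true  = ≡.cong not (dec-false (p₁ a ≟ p₂ a) (other₁-≢-other₂ (u≥2 a) (base a) (Equivalence.to (∈-Large {u = u}) (Q⊆Large (lookup⇒[]= a Q Qa)))))
    ... | false = ≡.cong not (dec-true (p₁ a ≟ p₁ a) ≡.refl)

  independent : (k : Fin (length Qs) → Carrier) → combo k basis ≈ₘ 0ₘ → ∀ i → k i ≈ 0#
  independent k combo≈0 i = begin
    k i                                ≈⟨ combo-nonBase k i p₁-nonBase (NonBase-representative Q) (≡.sym (differ-representative Q⊆Large)) ⟨
    combo k basis p₁ (representative Q) ≈⟨ combo≈0 _ _ ⟩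
    0#                                 ∎
    where
    Q = List.lookup Qs i
    Q⊆Large : Q ⊆ Large u
    Q⊆Large = proj₂ (∈-filter⁻ (_⊆? Large u) {xs = allSubsets n} (∈-lookup i))

  spanning : (M : Mat) → InZ M → Σ (Fin (length Qs) → Carrier) λ k → M ≈ₘ combo k basis
  spanning M (M-∈T , M-central) = k , central-agree M-central combo-central (InT-cong M-∈T) combo-cong p₁-nonBase agree
    where
    k : Fin (length Qs) → Carrier
    k j = M p₁ (representative (List.lookup Qs j))
    combo-central : Central (combo k basis)
    combo-central N N-∈T = commutesₘ-combo k basis (λ j → Y-central (List.lookup Qs j) N N-∈T)
    combo-cong : Respects≋ₘ (combo k basis)
    combo-cong {x} {x′} {y} {y′} x≋x′ y≋y′ = trans (combo-∑ k basis x y) (trans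
      (∑-cong (allFin (length Qs)) (λ j → *-congˡ (⊗-cong (yᶜ (List.lookup Qs j)) x≋x′ y≋y′))) (sym (combo-∑ k basis x′ y′)))
    agree : ∀ {x y} → NonBase x → NonBase y → M x y ≈ combo k basis x y
    agree {x} {y} x-nonBase y-nonBase = begin
      M x y                              ≈⟨ InT-normalise M-∈T x-nonBase y-nonBase ⟩
      M p₁ (representative (differ x y)) ≡⟨ ≡.cong (M p₁ ∘ representative) (lookup-index differ∈Qs) ⟩
      k (index differ∈Qs)                ≈⟨ combo-nonBase k (index differ∈Qs) x-nonBase y-nonBase (≡.sym (lookup-index differ∈Qs)) ⟨
      combo k basis x y                  ∎
      where
      differ∈Qs = ∈-filter⁺ (_⊆? Large u) (allSubsets-complete (differ x y)) (differ-⊆-Large x-nonBase y-nonBase)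

  dimension : DimZ≡ (length Qs)
  dimension = basis , (λ j → Y-∈T (List.lookup Qs j) , Y-central (List.lookup Qs j)) , independent , spanning

-- Counting closed subsets

open import Data.Nat using (_*_)

#closed-factorisation : {n : ℕ} (u : Fin n → ℕ) → (∀ a → 2 ≤ u a) → #closed u ≡ length (subsetsOf (Large u)) * #stronglyNormal u
#closed-factorisation {n} u u≥2 = count-by-bijection (subsetEnumeration (2 ^ n)) (subsetEnumeration (2 ^ n)) (subsetEnumeration n)
  (closed? u) (stronglyNormal? u) (_⊆? Large u) restriction saturation largeSupport
  (λ A-normal _ → Equivalence.from (closed⇔ u≥2) (restriction-closed (proj₁ (Equivalence.to (stronglyNormal⇔ u≥2) A-normal))))
  (λ A-closed → let open Closed (Equivalence.to (closed⇔ u≥2) A-closed) in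
                Equivalence.from (stronglyNormal⇔ u≥2) saturation-stronglyNormal , largeSupport-⊆)
  (λ A-closed → Closed.restriction-saturation (Equivalence.to (closed⇔ u≥2) A-closed))
  (λ A-normal D⊆Large → let open StronglyNormal (Equivalence.to (stronglyNormal⇔ u≥2) A-normal) in
                        saturation-restriction , largeSupport-restriction D⊆Large)
  where open ClosedSubsets u

corollary5p11 : ∀ {c ℓ : Level} (F : Field c ℓ) (n : ℕ) → 1 ≤ n →
    (u : Fin n → ℕ) → (∀ a → 2 ≤ u a) → (x : Pt u) →
    Σ ℕ λ m → Terwilliger.DimZ≡ F u x m × (#closed u ≡ m * #stronglyNormal u)
corollary5p11 F n _ u u≥2 x = length (subsetsOf (Large u)) , CentreBasis.dimension F u x u≥2 , #closed-factorisation u u≥2
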